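{- Let $H=(V,\mathcal E)$ be a $k$-uniform hypergraph ($k\ge 2$) with maximum degree at most $\Delta$, let $1\leq s \leq q$ be integers, let $h:[q]\to[s]$ be a balanced projection scheme, and let $\psi$ be the projected distribution. If $\lfloor q / s \rfloor^k\geq 4\mathrm{e}qs \Delta k$, then for any $v\in V$, any subset $\Lambda\subseteq V\setminus \{v\}$ and any partial configuration $\sigma_{\Lambda}\in [s]^{\Lambda}$, $$\forall j\in [s],\quad \frac{|h^{ -1}(j)|}{q}\left(1-\frac{1}{4s}\right)\leq\psi^{\sigma_\Lambda}_v(j) \leq \frac{|h^{ -1}(j)|}{q}\left(1+\frac{1}{s}\right).$$
   Context: A balanced projection scheme is a map $h:[q]\to[s]$ such that $|h^{ -1}(i)|\in\{\lfloor q/s\rfloor,\lceil q/s\rceil\}$ for every $i\in[s]$; it is extended to $X\in[q]^V$ coordinatewise. Let $\mu$ be the uniform distribution over proper $q$-colourings of $H$ (colourings with no monochromatic hyperedge). The projected distribution $\psi$ on $[s]^V$ is the law of $h(X)$ for $X\sim\mu$. For $\sigma_\Lambda\in[s]^\Lambda$, $\psi^{\sigma_\Lambda}_v$ is the marginal at $v$ of $\psi$ conditioned on $Y_\Lambda=\sigma_\Lambda$. -}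

module Defs where

open import Data.Nat using (ℕ; zero; suc; _+_; _*_; _∸_; _^_; _≤_; _<_; NonZero; _!; _/_)
open import Data.Nat.Properties using (_!≢0)
open import Data.Integer using (+_)
open import Data.Rational as ℚ using (ℚ)
open import Data.Fin using (Fin)
open import Data.Fin.Properties using (any?; all?; _≟_)
open import Data.Fin.Subset using (Subset; _∈_; _∉_; ∣_∣)
open import Data.Fin.Subset.Properties using (_∈?_)
open import Data.List using (List; []; _∷_; length; filter; concatMap; map; allFin)
open import Data.List.Relation.Unary.All using (All)
open import Data.List.Relation.Unary.Unique.Propositional using (Unique)
open import Data.Vec.Functional as VF using ()
open import Data.Product using (∃; _×_)
open import Relation.Nullary using (¬_; Dec; yes; no)
open import Relation.Nullary.Decidable using (_×-dec_; ¬?; _→-dec_)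
open import Relation.Binary.PropositionalEquality using (_≡_)
open import Data.Sum using (_⊎_)

record Hypergraph (n : ℕ) : Set where
  field
    edges  : List (Subset n)
    unique : Unique edges
open Hypergraph public

Uniform : ∀ {n} → ℕ → Hypergraph n → Set
Uniform k H = All (λ e → ∣ e ∣ ≡ k) (edges H)

degree : ∀ {n} → Hypergraph n → Fin n → ℕ
degree H v = length (filter (λ e → v ∈? e) (edges H))

MaxDegreeAtMost : ∀ {n} → ℕ → Hypergraph n → Set
MaxDegreeAtMost Δ H = ∀ v → degree H v ≤ Δ

Colouring : ℕ → ℕ → Set
Colouring n q = Fin n → Fin q

Monochromatic : ∀ {n q} → Colouring n q → Subset n → Set
Monochromatic {n} {q} X e = ∃ λ (c : Fin q) → ∀ (v : Fin n) → v ∈ e → X v ≡ c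

monochromatic? : ∀ {n q} (X : Colouring n q) (e : Subset n) → Dec (Monochromatic X e)
monochromatic? X e = any? λ c → all? λ v → (v ∈? e) →-dec (X v ≟ c)

Proper : ∀ {n q} → Hypergraph n → Colouring n q → Set
Proper H X = All (λ e → ¬ Monochromatic X e) (edges H)

proper? : ∀ {n q} (H : Hypergraph n) (X : Colouring n q) → Dec (Proper H X)
proper? H X = Data.List.Relation.Unary.All.all? (λ e → ¬? (monochromatic? X e)) (edges H)

allColourings : (n q : ℕ) → List (Colouring n q)
allColourings zero    q = (λ ()) ∷ []
allColourings (suc n) q =
  concatMap (λ c → map (λ f → c VF.∷ f) (allColourings n q)) (allFin q)

preimageSize : ∀ {q s} → (Fin q → Fin s) → Fin s → ℕ
preimageSize {q} h i = length (filter (λ x → h x ≟ i) (allFin q))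

⌈_/_⌉ : (q s : ℕ) → .{{NonZero s}} → ℕ
⌈ q / s ⌉ = (q + (s ∸ 1)) / s

Balanced : (q s : ℕ) → .{{NonZero s}} → (Fin q → Fin s) → Set
Balanced q s h = ∀ i → (preimageSize h i ≡ q / s) ⊎ (preimageSize h i ≡ ⌈ q / s ⌉)

-- Z(σ_Λ): number of proper colourings X with h(X)_Λ = σ_Λ
-- (a partial configuration σ_Λ ∈ [s]^Λ is given by any σ : Fin n → Fin s;
--  only its values on Λ are used)
Consistent : ∀ {n q s} → (Fin q → Fin s) → Subset n → (Fin n → Fin s) → Colouring n q → Set
Consistent {n} h Λ σ X = ∀ (u : Fin n) → u ∈ Λ → h (X u) ≡ σ u

consistent? : ∀ {n q s} (h : Fin q → Fin s) (Λ : Subset n) (σ : Fin n → Fin s)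
              (X : Colouring n q) → Dec (Consistent h Λ σ X)
consistent? h Λ σ X = all? λ u → (u ∈? Λ) →-dec (h (X u) ≟ σ u)

Zcond : ∀ {n q s} → Hypergraph n → (Fin q → Fin s) → Subset n → (Fin n → Fin s) → ℕ
Zcond {n} {q} H h Λ σ =
  length (filter (λ X → proper? H X ×-dec consistent? h Λ σ X) (allColourings n q))

Zcond-at : ∀ {n q s} → Hypergraph n → (Fin q → Fin s) → Subset n → (Fin n → Fin s)
           → Fin n → Fin s → ℕ
Zcond-at {n} {q} H h Λ σ v j =
  length (filter (λ X → (proper? H X ×-dec consistent? h Λ σ X) ×-dec (h (X v) ≟ j))
                 (allColourings n q))

-- ψ^{σ_Λ}_v(j) = Zcond-at / Zcond  (well defined when Zcond > 0)

invFact : ℕ → ℚ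
invFact i = ((+ 1) ℚ./ (i !)) {{i !≢0}}

eApprox : ℕ → ℚ
eApprox zero    = invFact zero
eApprox (suc N) = eApprox N ℚ.+ invFact (suc N)

-- "c · e ≤ x" for c ≥ 0 : since e = sup_N eApprox N, this holds iff c · eApprox N ≤ x for all N
_·e≤_ : ℚ → ℚ → Set
c ·e≤ x = ∀ N → c ℚ.* eApprox N ℚ.≤ x

toℚ : ℕ → ℚ
toℚ m = (+ m) ℚ./ 1

-- Let Z_c count the proper colourings consistent with σ_Λ that give v the colour c, so that
-- Z = Σ_c Z_c and Z(j) = Σ_{h(c) = j} Z_c; both bounds follow by averaging from
-- (4s − 1) Z_c′ ≤ 4s Z_c for all colours c, c′.
-- Recolouring v from c′ to c keeps a colouring proper unless some edge through v has all its
-- other vertices coloured c. Under the product weight in which every vertex other than v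
-- ranges over its admissible colours (at least L = ⌊q/s⌋ of them), such an edge has weight
-- at most L^-(k-1). A local-lemma induction (each edge is monochromatic with probability at
-- most 1/(2kΔ), even conditioned on avoiding any set of other edges) shows that conditioning
-- on properness at most doubles this, and summing over the at most Δ edges at v with
-- L^(k-1) ≥ 8Δs bounds the exceptional colourings by Z_c′/(4s).

module Submission where

open import Defs
open import Data.Nat using (ℕ; _+_; _*_; _∸_; _^_; _≤_; NonZero; _/_)
open import Data.Fin using (Fin)
open import Data.Fin.Subset using (Subset; _∉_)
open import Data.Product using (_×_)

open import Data.Nat using (zero; suc; _<_; z≤n; s≤s; >-nonZero; ≢-nonZero)
open import Data.Nat.Properties
open import Data.Nat.Tactic.RingSolver using (solve-∀)
open import Data.Fin using (zero; suc)
open import Data.Fin.Properties using (any?; all?) renaming (_≟_ to _≟ᶠ_)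
import Data.Fin.Properties as Finₚ
open import Data.Fin.Subset using (_∈_; ∣_∣; _-_; Nonempty)
open import Data.Fin.Subset.Properties using (_∈?_; p─⊥≡p; p─q⊆p; nonempty?; Empty-unique; ∣⊥∣≡0)
open import Data.Vec using ([]; _∷_; here; there)
open import Data.Bool using (Bool; true; false)
open import Data.List using (List; []; _∷_; length; filter; map; concatMap; tabulate; allFin; _++_)
open import Data.Product using (_,_; proj₁; proj₂; ∃)
open import Function using (_∘_; id)
open import Relation.Binary.PropositionalEquality
open import Relation.Nullary using (Dec; yes; no; ¬_)
open import Relation.Nullary.Decidable using (_×-dec_; _→-dec_; ¬?)
open import Data.Empty using (⊥-elim)
open import Data.Sum using (inj₁; inj₂)
open import Data.Nat.DivMod using (m/n≤m; m≥n⇒m/n>0; /-monoˡ-≤)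
import Data.Integer as ℤ
import Data.Integer.Properties as ℤₚ
open import Data.Rational as ℚ using (mkℚ; *≤*)
import Data.Rational.Properties as ℚₚ
import Data.Nat.Coprimality as Coprime
open import Data.List.Properties using (++-assoc; length-++-sucʳ)
open import Data.List.Relation.Unary.All as All using (All; []; _∷_)
open import Data.List.Relation.Unary.Any as Any using (Any; here; there)
import Data.List.Membership.Propositional as List
open import Data.List.Membership.Propositional.Properties using (∈-filter⁺)
open import Data.List.Relation.Unary.All.Properties using (¬Any⇒All¬)
open import Data.List.Relation.Unary.All.Properties using (++⁺; ++⁻; all-filter; filter⁺)
import Data.Vec.Functional as Vector
open import Level using (Level)
open import Algebra.Properties.CommutativeSemigroup *-commutativeSemigroup using (x∙yz≈y∙xz)
open import Algebra.Properties.Semiring.Sum +-*-semiring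
  using (sum; sum-syntax; sum-cong-≗; ∑-distrib-+; *-distribˡ-sum; *-distribʳ-sum; sum-replicate-zero)

private variable
  ℓᵃ ℓᵇ : Level
  A : Set ℓᵃ
  B : Set ℓᵇ

[m∸1]*z≤m*x : ∀ m x y z → z ≤ x + y → m * y ≤ z → (m ∸ 1) * z ≤ m * x
[m∸1]*z≤m*x m x y z z≤x+y my≤z = begin
  (m ∸ 1) * z            ≡⟨ *-distribʳ-∸ z m 1 ⟩
  m * z ∸ 1 * z          ≡⟨ cong (m * z ∸_) (*-identityˡ z) ⟩
  m * z ∸ z              ≤⟨ ∸-mono (*-monoʳ-≤ m z≤x+y) my≤z ⟩
  m * (x + y) ∸ m * y    ≡⟨ cong (_∸ m * y) (*-distribˡ-+ m x y) ⟩
  m * x + m * y ∸ m * y  ≡⟨ m+n∸n≡m (m * x) (m * y) ⟩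
  m * x                  ∎
  where open ≤-Reasoning

pow-increment-≤ : ∀ x a → suc x ^ suc a ≤ suc x * x ^ a + a * suc x ^ a
pow-increment-≤ x zero    = ≤-reflexive (sym (+-identityʳ _))
pow-increment-≤ x (suc a) = begin
  y * (y * y^a)                            ≤⟨ *-monoʳ-≤ y (pow-increment-≤ x a) ⟩
  y * (y * x^a + a * y^a)                  ≡⟨ distribute x x^a a y^a ⟩
  y * (x * x^a) + y * x^a + a * (y * y^a)
    ≤⟨ +-monoˡ-≤ (a * (y * y^a)) (+-monoʳ-≤ (y * (x * x^a)) (*-monoʳ-≤ y (^-monoˡ-≤ a (n≤1+n x)))) ⟩
  y * (x * x^a) + y * y^a + a * (y * y^a)  ≡⟨ +-assoc (y * (x * x^a)) _ _ ⟩
  y * (x * x^a) + suc a * (y * y^a)        ∎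
  where
  open ≤-Reasoning
  y = suc x
  x^a = x ^ a
  y^a = y ^ a
  distribute : ∀ y p a r → suc y * (suc y * p + a * r) ≡ suc y * (y * p) + suc y * p + a * (suc y * r)
  distribute = solve-∀

^≤2*pred^ : ∀ m a → 2 * a ≤ m → m ^ a ≤ 2 * (m ∸ 1) ^ a
^≤2*pred^ m       zero    _  = s≤s z≤n
^≤2*pred^ (suc x) (suc a) 2a≤m = *-cancelˡ-≤ (suc x) (begin
  suc x * y^a                                    ≤⟨ +-cancelʳ-≤ (suc x * y^a) _ _ twice ⟩
  2 * (suc x * x^a)                              ≡⟨ x∙yz≈y∙xz 2 (suc x) x^a ⟩
  suc x * (2 * x^a)                              ∎)
  where
  open ≤-Reasoning
  y^a = suc x ^ suc a
  x^a = x ^ suc a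
  twice : suc x * y^a + suc x * y^a ≤ 2 * (suc x * x^a) + suc x * y^a
  twice = begin
    suc x * y^a + suc x * y^a                    ≡⟨ cong (suc x * y^a +_) (sym (+-identityʳ _)) ⟩
    2 * (suc x * y^a)                            ≤⟨ *-monoʳ-≤ 2 (pow-increment-≤ x (suc a)) ⟩
    2 * (suc x * x^a + suc a * y^a)              ≡⟨ *-distribˡ-+ 2 (suc x * x^a) _ ⟩
    2 * (suc x * x^a) + 2 * (suc a * y^a)        ≡⟨ cong (2 * (suc x * x^a) +_) (sym (*-assoc 2 (suc a) y^a)) ⟩
    2 * (suc x * x^a) + 2 * suc a * y^a          ≤⟨ +-monoʳ-≤ (2 * (suc x * x^a)) (*-monoˡ-≤ y^a 2a≤m) ⟩
    2 * (suc x * x^a) + suc x * y^a              ∎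

^-positive : ∀ m a → 2 * a ≤ m → 0 < m ^ a
^-positive m       zero    _ = s≤s z≤n
^-positive (suc m) (suc a) _ = m^n>0 (suc m) (suc a)

4s∸1-ratio⇒s+1-ratio : ∀ s → 1 ≤ s → ∀ x y → (4 * s ∸ 1) * x ≤ 4 * s * y → s * x ≤ (s + 1) * y
4s∸1-ratio⇒s+1-ratio (suc t) _ x y ratio = *-cancelˡ-≤ (3 + 4 * t) (begin
  (3 + 4 * t) * (suc t * x)                    ≡⟨ x∙yz≈y∙xz (3 + 4 * t) (suc t) x ⟩
  suc t * ((3 + 4 * t) * x)                    ≤⟨ *-monoʳ-≤ (suc t) ratio′ ⟩
  suc t * ((4 + 4 * t) * y)                    ≤⟨ m≤m+n _ ((3 * t + 2) * y) ⟩
  suc t * ((4 + 4 * t) * y) + (3 * t + 2) * y  ≡⟨ expand t y ⟩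
  (3 + 4 * t) * ((suc t + 1) * y)              ∎)
  where
  open ≤-Reasoning
  ratio′ : (3 + 4 * t) * x ≤ (4 + 4 * t) * y
  ratio′ = subst₂ (λ a b → a * x ≤ b * y) (cong (_∸ 1) (*-suc 4 t)) (*-suc 4 t) ratio
  expand : ∀ t y → suc t * ((4 + 4 * t) * y) + (3 * t + 2) * y ≡ (3 + 4 * t) * ((suc t + 1) * y)
  expand = solve-∀

4s*B≤N : ∀ s Δ B N ℒ → B * ℒ ≤ Δ * (2 * N) → 8 * Δ * s ≤ ℒ → 1 ≤ ℒ → 4 * s * B ≤ N
4s*B≤N s zero    zero    N ℒ _ _ _ = ≤-trans (≤-reflexive (*-zeroʳ (4 * s))) z≤n
4s*B≤N s zero    (suc B) N ℒ B*ℒ≤0 _ 1≤ℒ = ⊥-elim (1+n≰n (≤-trans (≤-trans 1≤ℒ (m≤m+n ℒ (B * ℒ))) B*ℒ≤0))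
4s*B≤N s (suc Δ) B N ℒ B*ℒ≤ 8Δs≤ℒ _ = *-cancelˡ-≤ (2 * suc Δ) (begin
  2 * suc Δ * (4 * s * B)  ≡⟨ regroup (suc Δ) s B ⟩
  8 * suc Δ * s * B        ≤⟨ *-monoˡ-≤ B 8Δs≤ℒ ⟩
  ℒ * B                    ≡⟨ *-comm ℒ B ⟩
  B * ℒ                    ≤⟨ B*ℒ≤ ⟩
  suc Δ * (2 * N)          ≡⟨ x∙yz≈y∙xz (suc Δ) 2 N ⟩
  2 * (suc Δ * N)          ≡⟨ *-assoc 2 (suc Δ) N ⟨
  2 * suc Δ * N            ∎)
  where
  open ≤-Reasoning
  regroup : ∀ D s B → 2 * D * (4 * s * B) ≡ 8 * D * s * B
  regroup = solve-∀

^-pred-large : ∀ {L q s Δ} k → 1 ≤ L → L ≤ q → 1 ≤ k → 4 * q * s * Δ * k ≤ L ^ k → 4 * k * Δ * s ≤ L ^ (k ∸ 1)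
^-pred-large {L} {q} {s} {Δ} (suc k) 1≤L L≤q _ large = *-cancelˡ-≤ L {{>-nonZero 1≤L}} (begin
  L * (4 * suc k * Δ * s)   ≤⟨ *-monoˡ-≤ (4 * suc k * Δ * s) L≤q ⟩
  q * (4 * suc k * Δ * s)   ≡⟨ regroup q (suc k) Δ s ⟩
  4 * q * s * Δ * suc k     ≤⟨ large ⟩
  L * L ^ k                 ∎)
  where
  open ≤-Reasoning
  regroup : ∀ q k Δ s → q * (4 * k * Δ * s) ≡ 4 * q * s * Δ * k
  regroup = solve-∀

toℚ≡mkℚ : ∀ m → toℚ m ≡ mkℚ (ℤ.+ m) 0 (Coprime.sym (Coprime.1-coprimeTo m))
toℚ≡mkℚ m = ℚₚ.normalize-coprime (Coprime.sym (Coprime.1-coprimeTo m))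

toℚ-cancel-≤ : ∀ {a b} → toℚ a ℚ.≤ toℚ b → a ≤ b
toℚ-cancel-≤ {a} {b} a≤b with subst₂ ℚ._≤_ (toℚ≡mkℚ a) (toℚ≡mkℚ b) a≤b
... | *≤* a*1≤b*1 = ℤₚ.drop‿+≤+ (subst₂ ℤ._≤_ (ℤₚ.*-identityʳ (ℤ.+ a)) (ℤₚ.*-identityʳ (ℤ.+ b)) a*1≤b*1)

-- Only the zeroth partial sum of e (which is 1) is needed.
·e≤⇒≤ : ∀ a b → toℚ a ·e≤ toℚ b → a ≤ b
·e≤⇒≤ a b ae≤b = toℚ-cancel-≤ (subst (ℚ._≤ toℚ b) (ℚₚ.*-identityʳ (toℚ a)) (ae≤b 0))

χ : ∀ {p} {P : Set p} → Dec P → ℕ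
χ (yes _) = 1
χ (no _)  = 0

module _ {p} {P : Set p} where

  χ-yes : (d : Dec P) → P → χ d ≡ 1
  χ-yes (yes _) _  = refl
  χ-yes (no ¬p) x  = ⊥-elim (¬p x)

  χ-no : (d : Dec P) → ¬ P → χ d ≡ 0
  χ-no (yes x) ¬p = ⊥-elim (¬p x)
  χ-no (no _)  _  = refl

  χ≤1 : (d : Dec P) → χ d ≤ 1
  χ≤1 (yes _) = s≤s z≤n
  χ≤1 (no _)  = z≤n

  χ-¬+χ : (d : Dec P) → χ (¬? d) + χ d ≡ 1
  χ-¬+χ (yes _) = refl
  χ-¬+χ (no _)  = refl

χ-mono : ∀ {p r} {P : Set p} {Q : Set r} → (P → Q) → (d : Dec P) (e : Dec Q) → χ d ≤ χ e
χ-mono f (yes x) e = ≤-reflexive (sym (χ-yes e (f x)))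
χ-mono f (no _)  e = z≤n

module _ {p r} {P : Set p} {Q : Set r} where

  χ-cong : (P → Q) → (Q → P) → (d : Dec P) (e : Dec Q) → χ d ≡ χ e
  χ-cong f g d e = ≤-antisym (χ-mono f d e) (χ-mono g e d)

  χ-× : (d : Dec P) (e : Dec Q) → χ (d ×-dec e) ≡ χ d * χ e
  χ-× (yes _) (yes _) = refl
  χ-× (yes _) (no _)  = refl
  χ-× (no _)  (yes _) = refl
  χ-× (no _)  (no _)  = refl

χ*≤ : ∀ {p} {P : Set p} (d : Dec P) x → χ d * x ≤ x
χ*≤ d x = ≤-trans (*-monoˡ-≤ x (χ≤1 d)) (≤-reflexive (*-identityˡ x))

sum-mono : ∀ {m} {f g : Fin m → ℕ} → (∀ i → f i ≤ g i) → sum f ≤ sum g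
sum-mono {zero}  f≤g = z≤n
sum-mono {suc m} f≤g = +-mono-≤ (f≤g zero) (sum-mono (f≤g ∘ suc))

term≤sum : ∀ {m} (f : Fin m → ℕ) i → f i ≤ sum f
term≤sum f zero    = m≤m+n _ _
term≤sum f (suc i) = ≤-trans (term≤sum (f ∘ suc) i) (m≤n+m _ _)

sum-const : ∀ {m} a → sum {m} (λ _ → a) ≡ m * a
sum-const {zero}  a = refl
sum-const {suc m} a = cong (a +_) (sum-const {m} a)

sum-*-sum : ∀ {m m′} (f : Fin m → ℕ) (g : Fin m′ → ℕ) →
  sum f * sum g ≡ ∑[ i < m ] ∑[ j < m′ ] (f i * g j)
sum-*-sum f g = trans (*-distribʳ-sum (sum g) f) (sum-cong-≗ (λ i → *-distribˡ-sum (f i) g))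

sum-pick : ∀ {m} (x : Fin m) (f : Fin m → ℕ) → ∑[ c < m ] (χ (x ≟ᶠ c) * f c) ≡ f x
sum-pick {suc m} zero f = begin
  1 * f zero + ∑[ c < m ] (χ (zero ≟ᶠ suc c) * f (suc c))
    ≡⟨ cong (1 * f zero +_) (sum-cong-≗ (λ c → cong (_* f (suc c)) (χ-no (zero ≟ᶠ suc c) λ ()))) ⟩
  1 * f zero + ∑[ c < m ] (0 * f (suc c))   ≡⟨ cong (1 * f zero +_) (sum-replicate-zero m) ⟩
  f zero + 0 + 0                          ≡⟨ trans (+-identityʳ _) (+-identityʳ _) ⟩
  f zero                                  ∎
  where open ≡-Reasoning
sum-pick {suc m} (suc x) f = begin
  0 * f zero + ∑[ c < m ] (χ (suc x ≟ᶠ suc c) * f (suc c))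
    ≡⟨ sum-cong-≗ (λ c → cong (_* f (suc c)) (χ-cong Finₚ.suc-injective (cong suc) (suc x ≟ᶠ suc c) (x ≟ᶠ c))) ⟩
  ∑[ c < m ] (χ (x ≟ᶠ c) * f (suc c))       ≡⟨ sum-pick x (f ∘ suc) ⟩
  f (suc x)                               ∎
  where open ≡-Reasoning

sum-pick′ : ∀ {m} (x : Fin m) (f : Fin m → ℕ) → ∑[ c < m ] (χ (c ≟ᶠ x) * f c) ≡ f x
sum-pick′ x f = trans (sum-cong-≗ (λ c → cong (_* f c) (χ-cong sym sym (c ≟ᶠ x) (x ≟ᶠ c)))) (sum-pick x f)

module _ {q : ℕ} (w N : Fin q → ℕ) where

  sum*sum≡∑∑ : ∀ a → sum w * a * sum N ≡ ∑[ c < q ] ∑[ c′ < q ] (w c * (a * N c′))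
  sum*sum≡∑∑ a = begin
    sum w * a * sum N                     ≡⟨ *-assoc (sum w) a (sum N) ⟩
    sum w * (a * sum N)                   ≡⟨ cong (sum w *_) (*-distribˡ-sum a N) ⟩
    sum w * ∑[ c′ < q ] (a * N c′)        ≡⟨ sum-*-sum w (λ c′ → a * N c′) ⟩
    ∑[ c < q ] ∑[ c′ < q ] (w c * (a * N c′)) ∎
    where open ≡-Reasoning

  *q*sum≡∑∑ : ∀ b → b * q * ∑[ c < q ] (w c * N c) ≡ ∑[ c < q ] ∑[ c′ < q ] (w c * (b * N c))
  *q*sum≡∑∑ b = begin
    b * q * ∑[ c < q ] (w c * N c)        ≡⟨ *-distribˡ-sum (b * q) (λ c → w c * N c) ⟩
    ∑[ c < q ] (b * q * (w c * N c))      ≡⟨ sum-cong-≗ {q} (λ c → regroup b q (w c) (N c)) ⟩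
    ∑[ c < q ] (q * (w c * (b * N c)))    ≡⟨ sum-cong-≗ {q} (λ c → sum-const {q} (w c * (b * N c))) ⟨
    ∑[ c < q ] ∑[ c′ < q ] (w c * (b * N c)) ∎
    where
    open ≡-Reasoning
    regroup : ∀ b q x y → b * q * (x * y) ≡ q * (x * (b * y))
    regroup = solve-∀

  weighted-average-≥ : ∀ a b → (∀ c c′ → a * N c′ ≤ b * N c) → sum w * a * sum N ≤ b * q * ∑[ c < q ] (w c * N c)
  weighted-average-≥ a b aN≤bN = begin
    sum w * a * sum N                          ≡⟨ sum*sum≡∑∑ a ⟩
    ∑[ c < q ] ∑[ c′ < q ] (w c * (a * N c′))  ≤⟨ sum-mono {q} (λ c → sum-mono {q} (λ c′ → *-monoʳ-≤ (w c) (aN≤bN c c′))) ⟩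
    ∑[ c < q ] ∑[ c′ < q ] (w c * (b * N c))   ≡⟨ *q*sum≡∑∑ b ⟨
    b * q * ∑[ c < q ] (w c * N c)             ∎
    where open ≤-Reasoning

  weighted-average-≤ : ∀ a b → (∀ c c′ → b * N c ≤ a * N c′) → b * q * ∑[ c < q ] (w c * N c) ≤ sum w * a * sum N
  weighted-average-≤ a b bN≤aN = begin
    b * q * ∑[ c < q ] (w c * N c)             ≡⟨ *q*sum≡∑∑ b ⟩
    ∑[ c < q ] ∑[ c′ < q ] (w c * (b * N c))   ≤⟨ sum-mono {q} (λ c → sum-mono {q} (λ c′ → *-monoʳ-≤ (w c) (bN≤aN c c′))) ⟩
    ∑[ c < q ] ∑[ c′ < q ] (w c * (a * N c′))  ≡⟨ sum*sum≡∑∑ a ⟨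
    sum w * a * sum N                          ∎
    where open ≤-Reasoning

sumOver : (A → ℕ) → List A → ℕ
sumOver f []       = 0
sumOver f (x ∷ xs) = f x + sumOver f xs

sumOver-++ : ∀ (f : A → ℕ) xs ys → sumOver f (xs ++ ys) ≡ sumOver f xs + sumOver f ys
sumOver-++ f []       ys = refl
sumOver-++ f (x ∷ xs) ys = trans (cong (f x +_) (sumOver-++ f xs ys)) (sym (+-assoc (f x) _ _))

sumOver-mono : ∀ {f g : A → ℕ} → (∀ x → f x ≤ g x) → ∀ xs → sumOver f xs ≤ sumOver g xs
sumOver-mono f≤g []       = z≤n
sumOver-mono f≤g (x ∷ xs) = +-mono-≤ (f≤g x) (sumOver-mono f≤g xs)

sumOver-*ˡ : ∀ k (f : A → ℕ) xs → sumOver (λ x → k * f x) xs ≡ k * sumOver f xs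
sumOver-*ˡ k f []       = sym (*-zeroʳ k)
sumOver-*ˡ k f (x ∷ xs) = trans (cong (k * f x +_) (sumOver-*ˡ k f xs)) (sym (*-distribˡ-+ k (f x) _))

sumOver-tabulate : ∀ {m} (f : A → ℕ) (g : Fin m → A) → sumOver f (tabulate g) ≡ sum (f ∘ g)
sumOver-tabulate {m = zero}  f g = refl
sumOver-tabulate {m = suc m} f g = cong (f (g zero) +_) (sumOver-tabulate f (g ∘ suc))

sumOver-sum : ∀ {m} (f : Fin m → A → ℕ) xs →
  sumOver (λ x → ∑[ i < m ] f i x) xs ≡ ∑[ i < m ] sumOver (f i) xs
sumOver-sum {m = m} f []       = sym (sum-replicate-zero m)
sumOver-sum     f (x ∷ xs) = trans (cong (sum (λ i → f i x) +_) (sumOver-sum f xs))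
                                   (sym (∑-distrib-+ (λ i → f i x) (λ i → sumOver (f i) xs)))

length-filter : ∀ {p} {P : A → Set p} (P? : ∀ x → Dec (P x)) xs →
  length (filter P? xs) ≡ sumOver (χ ∘ P?) xs
length-filter P? []       = refl
length-filter P? (x ∷ xs) with P? x
... | yes _ = cong suc (length-filter P? xs)
... | no _  = length-filter P? xs

sumOver-map : ∀ (f : B → ℕ) (g : A → B) xs → sumOver f (map g xs) ≡ sumOver (f ∘ g) xs
sumOver-map f g []       = refl
sumOver-map f g (x ∷ xs) = cong (f (g x) +_) (sumOver-map f g xs)

sumOver-concatMap : ∀ (f : B → ℕ) (g : A → List B) xs →
  sumOver f (concatMap g xs) ≡ sumOver (sumOver f ∘ g) xs
sumOver-concatMap f g []       = refl
sumOver-concatMap f g (x ∷ xs) =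
  trans (sumOver-++ f (g x) (concatMap g xs)) (cong (sumOver f (g x) +_) (sumOver-concatMap f g xs))

module _ {p} {P : A → Set p} (P? : ∀ x → Dec (P x)) where

  length-filter-insert : ∀ xs y ys → length (filter P? (xs ++ ys)) ≤ length (filter P? (xs ++ y ∷ ys))
  length-filter-insert []       y ys with P? y
  ... | yes _ = n≤1+n _
  ... | no _  = ≤-refl
  length-filter-insert (x ∷ xs) y ys with P? x
  ... | yes _ = s≤s (length-filter-insert xs y ys)
  ... | no _  = length-filter-insert xs y ys

All-remove : ∀ {p} {P : A → Set p} xs {y} ys → All P (xs ++ y ∷ ys) → All P (xs ++ ys) × P y
All-remove xs ys all with ++⁻ xs all
... | all-xs , (Py ∷ all-ys) = ++⁺ all-xs all-ys , Py

sumOver-≥-any : ∀ {p} {P : A → Set p} {k} {f : A → ℕ} {xs} → (∀ {x} → P x → k ≤ f x) → Any P xs → k ≤ sumOver f xs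
sumOver-≥-any k≤f (here Px)  = ≤-trans (k≤f Px) (m≤m+n _ _)
sumOver-≥-any k≤f (there Pxs) = ≤-trans (sumOver-≥-any k≤f Pxs) (m≤n+m _ _)

sumOver-*-≤ : ∀ (f : A → ℕ) c b xs → All (λ x → f x * c ≤ b) xs → sumOver f xs * c ≤ length xs * b
sumOver-*-≤ f c b []       []             = z≤n
sumOver-*-≤ f c b (x ∷ xs) (fx*c≤b ∷ all) =
  ≤-trans (≤-reflexive (*-distribʳ-+ c (f x) _)) (+-mono-≤ fx*c≤b (sumOver-*-≤ f c b xs all))

x∉p-x : ∀ {n} (p : Subset n) x → x ∉ p - x
x∉p-x (_ ∷ p) zero    ()
x∉p-x (_ ∷ p) (suc x) (there x∈p-x) = x∉p-x p x x∈p-x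

y∈p-x⇒y≢x : ∀ {n} {p : Subset n} {x y} → y ∈ p - x → y ≢ x
y∈p-x⇒y≢x {p = p} {x} y∈p-x refl = x∉p-x p x y∈p-x

∣p-x∣+1≡∣p∣ : ∀ {n} {p : Subset n} {x} → x ∈ p → suc ∣ p - x ∣ ≡ ∣ p ∣
∣p-x∣+1≡∣p∣ {p = true ∷ p}  {zero}  here = cong suc (cong ∣_∣ (p─⊥≡p p))
∣p-x∣+1≡∣p∣ {p = true ∷ p}  {suc x} (there x∈p) = cong suc (∣p-x∣+1≡∣p∣ x∈p)
∣p-x∣+1≡∣p∣ {p = false ∷ p} {suc x} (there x∈p) = ∣p-x∣+1≡∣p∣ x∈p

∣p∣>0⇒Nonempty : ∀ {n} {p : Subset n} → 0 < ∣ p ∣ → Nonempty p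
∣p∣>0⇒Nonempty {n} {p} 0<∣p∣ with nonempty? p
... | yes p≢∅ = p≢∅
... | no p≡∅  = ⊥-elim (<⇒≢ 0<∣p∣ (sym (trans (cong ∣_∣ (Empty-unique p≡∅)) (∣⊥∣≡0 n))))

χ-suc∈≡χ-∈ : ∀ {n} b (p : Subset n) u → χ (suc u ∈? b ∷ p) ≡ χ (u ∈? p)
χ-suc∈≡χ-∈ b p u = χ-cong (λ { (there u∈p) → u∈p }) there (suc u ∈? b ∷ p) (u ∈? p)

∑χ∈≡∣p∣ : ∀ {n} (p : Subset n) → ∑[ u < n ] χ (u ∈? p) ≡ ∣ p ∣
∑χ∈≡∣p∣ []                  = refl
∑χ∈≡∣p∣ {suc n} (true ∷ p)  = cong suc (trans (sum-cong-≗ {n} (χ-suc∈≡χ-∈ true p)) (∑χ∈≡∣p∣ p))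
∑χ∈≡∣p∣ {suc n} (false ∷ p) = trans (sum-cong-≗ {n} (χ-suc∈≡χ-∈ false p)) (∑χ∈≡∣p∣ p)

Meets : ∀ {n} → Subset n → Subset n → Set
Meets W g = ∃ λ u → u ∈ W × u ∈ g

meets? : ∀ {n} (W g : Subset n) → Dec (Meets W g)
meets? W g = any? (λ u → (u ∈? W) ×-dec (u ∈? g))

χ-meets≤∑ : ∀ {n} (W g : Subset n) → χ (meets? W g) ≤ ∑[ u < n ] (χ (u ∈? W) * χ (u ∈? g))
χ-meets≤∑ W g with meets? W g
... | no _ = z≤n
... | yes (u , u∈W , u∈g) = ≤-trans (≤-reflexive (sym (cong₂ _*_ (χ-yes (u ∈? W) u∈W) (χ-yes (u ∈? g) u∈g))))
                                    (term≤sum (λ u → χ (u ∈? W) * χ (u ∈? g)) u)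

edgesMeeting-≤ : ∀ {n Δ} (H : Hypergraph n) → MaxDegreeAtMost Δ H → ∀ W →
  length (filter (meets? W) (edges H)) ≤ ∣ W ∣ * Δ
edgesMeeting-≤ {n} {Δ} H maxDegree W = begin
  length (filter (meets? W) E)                                  ≡⟨ length-filter (meets? W) E ⟩
  sumOver (λ g → χ (meets? W g)) E                              ≤⟨ sumOver-mono (χ-meets≤∑ W) E ⟩
  sumOver (λ g → ∑[ u < n ] (χ (u ∈? W) * χ (u ∈? g))) E        ≡⟨ sumOver-sum (λ u g → χ (u ∈? W) * χ (u ∈? g)) E ⟩
  ∑[ u < n ] sumOver (λ g → χ (u ∈? W) * χ (u ∈? g)) E
    ≡⟨ sum-cong-≗ {n} (λ u → sumOver-*ˡ (χ (u ∈? W)) (λ g → χ (u ∈? g)) E) ⟩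
  ∑[ u < n ] (χ (u ∈? W) * sumOver (λ g → χ (u ∈? g)) E)
    ≤⟨ sum-mono {n} (λ u → *-monoʳ-≤ (χ (u ∈? W)) (≤-trans (≤-reflexive (sym (length-filter (u ∈?_) E))) (maxDegree u))) ⟩
  ∑[ u < n ] (χ (u ∈? W) * Δ)                                   ≡⟨ *-distribʳ-sum Δ (λ u → χ (u ∈? W)) ⟨
  (∑[ u < n ] χ (u ∈? W)) * Δ                                   ≡⟨ cong (_* Δ) (∑χ∈≡∣p∣ W) ⟩
  ∣ W ∣ * Δ                                                     ∎
  where
  open ≤-Reasoning
  E = edges H

preimageSize≡∑ : ∀ {q s} (h : Fin q → Fin s) i → preimageSize h i ≡ ∑[ x < q ] χ (h x ≟ᶠ i)
preimageSize≡∑ {q} h i = trans (length-filter (λ x → h x ≟ᶠ i) (allFin q)) (sumOver-tabulate (λ x → χ (h x ≟ᶠ i)) id)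

balanced⇒/≤preimageSize : ∀ {q s} .{{_ : NonZero s}} {h : Fin q → Fin s} → Balanced q s h → ∀ i → q / s ≤ preimageSize h i
balanced⇒/≤preimageSize {q} {s} balanced i with balanced i
... | inj₁ size≡⌊q/s⌋ = ≤-reflexive (sym size≡⌊q/s⌋)
... | inj₂ size≡⌈q/s⌉ = ≤-trans (/-monoˡ-≤ s (m≤m+n q (s ∸ 1))) (≤-reflexive (sym size≡⌈q/s⌉))

-- Weighted counting of colourings

module _ {q : ℕ} where

  total : ∀ n → (Colouring n q → ℕ) → ℕ
  total zero    w = w (λ ())
  total (suc n) w = ∑[ c < q ] total n (λ X → w (c Vector.∷ X))

  total-cong : ∀ n {w w′ : Colouring n q → ℕ} → (∀ X → w X ≡ w′ X) → total n w ≡ total n w′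
  total-cong zero    w≡w′ = w≡w′ _
  total-cong (suc n) w≡w′ = sum-cong-≗ {q} (λ c → total-cong n (λ X → w≡w′ _))

  total-mono : ∀ n {w w′ : Colouring n q → ℕ} → (∀ X → w X ≤ w′ X) → total n w ≤ total n w′
  total-mono zero    w≤w′ = w≤w′ _
  total-mono (suc n) w≤w′ = sum-mono {q} (λ c → total-mono n (λ X → w≤w′ _))

  total-+ : ∀ n (w w′ : Colouring n q → ℕ) → total n (λ X → w X + w′ X) ≡ total n w + total n w′
  total-+ zero    w w′ = refl
  total-+ (suc n) w w′ = trans (sum-cong-≗ {q} (λ c → total-+ n _ _))
    (∑-distrib-+ (λ c → total n (λ X → w (c Vector.∷ X))) (λ c → total n (λ X → w′ (c Vector.∷ X))))

  total-*ˡ : ∀ n k (w : Colouring n q → ℕ) → total n (λ X → k * w X) ≡ k * total n w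
  total-*ˡ zero    k w = refl
  total-*ˡ (suc n) k w = trans (sum-cong-≗ {q} (λ c → total-*ˡ n k _)) (sym (*-distribˡ-sum k (λ c → total n (λ X → w (c Vector.∷ X)))))

  total-zero : ∀ n → total n (λ _ → 0) ≡ 0
  total-zero zero    = refl
  total-zero (suc n) = trans (sum-cong-≗ {q} (λ c → total-zero n)) (sum-replicate-zero q)

  total-sum : ∀ n {m} (w : Fin m → Colouring n q → ℕ) →
    total n (λ X → ∑[ i < m ] w i X) ≡ ∑[ i < m ] total n (w i)
  total-sum n {zero}  w = total-zero n
  total-sum n {suc m} w = trans (total-+ n (w zero) _) (cong (total n (w zero) +_) (total-sum n (w ∘ suc)))

  total-sumOver : ∀ n (w : A → Colouring n q → ℕ) xs →
    total n (λ X → sumOver (λ x → w x X) xs) ≡ sumOver (λ x → total n (w x)) xs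
  total-sumOver n w []       = total-zero n
  total-sumOver n w (x ∷ xs) = trans (total-+ n (w x) _) (cong (total n (w x) +_) (total-sumOver n w xs))

  count≡total : ∀ n {p} {P : Colouring n q → Set p} (P? : ∀ X → Dec (P X)) →
    length (filter P? (allColourings n q)) ≡ total n (χ ∘ P?)
  count≡total zero    P? = trans (length-filter P? _) (+-identityʳ _)
  count≡total (suc n) P? = begin
    length (filter P? (allColourings (suc n) q))
      ≡⟨ length-filter P? (allColourings (suc n) q) ⟩
    sumOver (χ ∘ P?) (concatMap extensions (allFin q))
      ≡⟨ sumOver-concatMap (χ ∘ P?) extensions (allFin q) ⟩
    sumOver (sumOver (χ ∘ P?) ∘ extensions) (allFin q)
      ≡⟨ sumOver-tabulate (sumOver (χ ∘ P?) ∘ extensions) id ⟩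
    ∑[ c < q ] sumOver (χ ∘ P?) (extensions c)
      ≡⟨ sum-cong-≗ {q} (λ c → trans (sumOver-map (χ ∘ P?) (c Vector.∷_) (allColourings n q))
                                 (trans (sym (length-filter (P? ∘ (c Vector.∷_)) (allColourings n q)))
                                        (count≡total n (P? ∘ (c Vector.∷_))))) ⟩
    total (suc n) (χ ∘ P?) ∎
    where
    open ≡-Reasoning
    extensions : Fin q → List (Colouring (suc n) q)
    extensions c = map (c Vector.∷_) (allColourings n q)

  productWeight : ∀ {n} → (Fin n → Fin q → ℕ) → Colouring n q → ℕ
  productWeight {zero}  ℓ X = 1
  productWeight {suc n} ℓ X = ℓ zero (X zero) * productWeight (ℓ ∘ suc) (X ∘ suc)

  DependsOnlyOn : ∀ {n} → (Fin n → Set) → (Colouring n q → ℕ) → Set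
  DependsOnlyOn {n} P w = ∀ (X Y : Colouring n q) → (∀ u → P u → X u ≡ Y u) → w X ≡ w Y

  module _ {n} {b : Bool} {W : Subset n} {w : Colouring (suc n) q → ℕ} where

    dependsOnlyOn-∈-tail : DependsOnlyOn (_∈ b ∷ W) w → ∀ c → DependsOnlyOn (_∈ W) (w ∘ (c Vector.∷_))
    dependsOnlyOn-∈-tail w-dep c X Y X≡Y = w-dep _ _ λ { zero _ → refl ; (suc u) (there u∈W) → X≡Y u u∈W }

    dependsOnlyOn-∉-tail : DependsOnlyOn (_∉ b ∷ W) w → ∀ c → DependsOnlyOn (_∉ W) (w ∘ (c Vector.∷_))
    dependsOnlyOn-∉-tail w-dep c X Y X≡Y = w-dep _ _ λ { zero _ → refl ; (suc u) u∉ → X≡Y u (u∉ ∘ there) }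

  module _ {n} {W : Subset n} {w : Colouring (suc n) q → ℕ} where

    dependsOnlyOn-∈-ignoresHead : DependsOnlyOn (_∈ false ∷ W) w → ∀ c d X → w (c Vector.∷ X) ≡ w (d Vector.∷ X)
    dependsOnlyOn-∈-ignoresHead w-dep c d X = w-dep _ _ λ { zero () ; (suc u) _ → refl }

    dependsOnlyOn-∉-ignoresHead : DependsOnlyOn (_∉ true ∷ W) w → ∀ c d X → w (c Vector.∷ X) ≡ w (d Vector.∷ X)
    dependsOnlyOn-∉-ignoresHead w-dep c d X = w-dep _ _ λ { zero 0∉ → ⊥-elim (0∉ here) ; (suc u) _ → refl }

  total-product : ∀ n (ℓ : Fin (suc n) → Fin q → ℕ) →
    total (suc n) (productWeight ℓ) ≡ ∑[ c < q ] (ℓ zero c * total n (productWeight (ℓ ∘ suc)))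
  total-product n ℓ = sum-cong-≗ {q} (λ c → total-*ˡ n (ℓ zero c) _)

  total-weighted-product : ∀ n (ℓ : Fin (suc n) → Fin q → ℕ) (w : Colouring (suc n) q → ℕ) →
    total (suc n) (λ X → w X * productWeight ℓ X)
      ≡ ∑[ c < q ] (ℓ zero c * total n (λ X → w (c Vector.∷ X) * productWeight (ℓ ∘ suc) X))
  total-weighted-product n ℓ w =
    sum-cong-≗ {q} (λ c → trans (total-cong n (λ X → swap-middle (w _) (ℓ zero c) _)) (total-*ˡ n (ℓ zero c) _))
    where
    swap-middle : ∀ x y z → x * (y * z) ≡ y * (x * z)
    swap-middle = solve-∀

  ∑-cross-factor : (ℓ f g h : Fin q → ℕ) (y : ℕ) → (∀ c → f c * y ≡ g c * h c) → (∀ c d → h c ≡ h d) →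
    ∑[ c < q ] (ℓ c * f c) * ∑[ d < q ] (ℓ d * y) ≡ ∑[ c < q ] (ℓ c * g c) * ∑[ d < q ] (ℓ d * h d)
  ∑-cross-factor ℓ f g h y fy≡gh h-const = begin
    ∑[ c < q ] (ℓ c * f c) * ∑[ d < q ] (ℓ d * y)
      ≡⟨ sum-*-sum (λ c → ℓ c * f c) (λ d → ℓ d * y) ⟩
    ∑[ c < q ] ∑[ d < q ] (ℓ c * f c * (ℓ d * y))
      ≡⟨ sum-cong-≗ {q} (λ c → sum-cong-≗ {q} (λ d → term c d)) ⟩
    ∑[ c < q ] ∑[ d < q ] (ℓ c * g c * (ℓ d * h d))
      ≡⟨ sym (sum-*-sum (λ c → ℓ c * g c) (λ d → ℓ d * h d)) ⟩
    ∑[ c < q ] (ℓ c * g c) * ∑[ d < q ] (ℓ d * h d) ∎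
    where
    open ≡-Reasoning
    regroup : ∀ a b c d → a * b * (c * d) ≡ a * c * (b * d)
    regroup = solve-∀
    term : ∀ c d → ℓ c * f c * (ℓ d * y) ≡ ℓ c * g c * (ℓ d * h d)
    term c d = begin
      ℓ c * f c * (ℓ d * y)   ≡⟨ regroup (ℓ c) (f c) (ℓ d) y ⟩
      ℓ c * ℓ d * (f c * y)   ≡⟨ cong (ℓ c * ℓ d *_) (trans (fy≡gh c) (cong (g c *_) (h-const c d))) ⟩
      ℓ c * ℓ d * (g c * h d) ≡⟨ regroup (ℓ c) (ℓ d) (g c) (h d) ⟩
      ℓ c * g c * (ℓ d * h d) ∎

  -- Induct on the vertices: whichever of a and b ignores the first vertex has a tail mass
  -- that does not depend on its colour.
  total-independent : ∀ {n} (W : Subset n) (ℓ : Fin n → Fin q → ℕ) (a b : Colouring n q → ℕ) →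
    DependsOnlyOn (_∈ W) a → DependsOnlyOn (_∉ W) b →
    total n (λ X → a X * b X * productWeight ℓ X) * total n (productWeight ℓ)
      ≡ total n (λ X → a X * productWeight ℓ X) * total n (λ X → b X * productWeight ℓ X)
  total-independent {zero} [] ℓ a b _ _ = regroup (a _) (b _)
    where
    regroup : ∀ x y → x * y * 1 * 1 ≡ x * 1 * (y * 1)
    regroup = solve-∀
  total-independent {suc n} (side ∷ W) ℓ a b a-dep b-dep = begin
    total (suc n) (λ X → a X * b X * productWeight ℓ X) * total (suc n) (productWeight ℓ)
      ≡⟨ cong₂ _*_ (total-weighted-product n ℓ (λ X → a X * b X)) (total-product n ℓ) ⟩
    ∑[ c < q ] (ℓ zero c * joint c) * ∑[ d < q ] (ℓ zero d * mass)
      ≡⟨ by-side side a-dep b-dep ⟩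
    ∑[ c < q ] (ℓ zero c * marginalᵃ c) * ∑[ d < q ] (ℓ zero d * marginalᵇ d)
      ≡⟨ sym (cong₂ _*_ (total-weighted-product n ℓ a) (total-weighted-product n ℓ b)) ⟩
    total (suc n) (λ X → a X * productWeight ℓ X) * total (suc n) (λ X → b X * productWeight ℓ X) ∎
    where
    open ≡-Reasoning
    π = productWeight (ℓ ∘ suc)
    joint = λ c → total n (λ X → a (c Vector.∷ X) * b (c Vector.∷ X) * π X)
    mass = total n π
    marginalᵃ = λ c → total n (λ X → a (c Vector.∷ X) * π X)
    marginalᵇ = λ c → total n (λ X → b (c Vector.∷ X) * π X)
    tail-independent : ∀ x → DependsOnlyOn (_∈ x ∷ W) a → DependsOnlyOn (_∉ x ∷ W) b →
      ∀ c → joint c * mass ≡ marginalᵃ c * marginalᵇ c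
    tail-independent x a-dep b-dep c = total-independent W (ℓ ∘ suc) (a ∘ (c Vector.∷_)) (b ∘ (c Vector.∷_))
      (dependsOnlyOn-∈-tail a-dep c) (dependsOnlyOn-∉-tail b-dep c)
    by-side : ∀ x → DependsOnlyOn (_∈ x ∷ W) a → DependsOnlyOn (_∉ x ∷ W) b →
      ∑[ c < q ] (ℓ zero c * joint c) * ∑[ d < q ] (ℓ zero d * mass)
        ≡ ∑[ c < q ] (ℓ zero c * marginalᵃ c) * ∑[ d < q ] (ℓ zero d * marginalᵇ d)
    by-side true a-dep b-dep = ∑-cross-factor (ℓ zero) joint marginalᵃ marginalᵇ mass (tail-independent true a-dep b-dep)
      (λ c d → total-cong n (λ X → cong (_* π X) (dependsOnlyOn-∉-ignoresHead b-dep c d X)))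
    by-side false a-dep b-dep = trans
      (∑-cross-factor (ℓ zero) joint marginalᵇ marginalᵃ mass
        (λ c → trans (tail-independent false a-dep b-dep c) (*-comm (marginalᵃ c) (marginalᵇ c)))
        (λ c d → total-cong n (λ X → cong (_* π X) (dependsOnlyOn-∈-ignoresHead a-dep c d X))))
      (*-comm (∑[ c < q ] (ℓ zero c * marginalᵇ c)) (∑[ d < q ] (ℓ zero d * marginalᵃ d)))

  isConstOn : ∀ {n} → Subset n → Fin q → Colouring n q → ℕ
  isConstOn []          c X = 1
  isConstOn (true ∷ p)  c X = χ (X zero ≟ᶠ c) * isConstOn p c (X ∘ suc)
  isConstOn (false ∷ p) c X = isConstOn p c (X ∘ suc)

  isConstOn≡1 : ∀ {n} (p : Subset n) c (X : Colouring n q) → (∀ u → u ∈ p → X u ≡ c) → isConstOn p c X ≡ 1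
  isConstOn≡1 []          c X X≡c = refl
  isConstOn≡1 (true ∷ p)  c X X≡c =
    cong₂ _*_ (χ-yes (X zero ≟ᶠ c) (X≡c zero here)) (isConstOn≡1 p c _ (λ u u∈p → X≡c (suc u) (there u∈p)))
  isConstOn≡1 (false ∷ p) c X X≡c = isConstOn≡1 p c _ (λ u u∈p → X≡c (suc u) (there u∈p))

  isConstOn≤1 : ∀ {n} (p : Subset n) c (X : Colouring n q) → isConstOn p c X ≤ 1
  isConstOn≤1 []          c X = ≤-refl
  isConstOn≤1 (true ∷ p)  c X = *-mono-≤ (χ≤1 (X zero ≟ᶠ c)) (isConstOn≤1 p c _)
  isConstOn≤1 (false ∷ p) c X = isConstOn≤1 p c _

  isConstOn-dependsOnlyOn : ∀ {n} (p : Subset n) c → DependsOnlyOn (_∈ p) (isConstOn p c)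
  isConstOn-dependsOnlyOn []          c X Y X≡Y = refl
  isConstOn-dependsOnlyOn (true ∷ p)  c X Y X≡Y = cong₂ _*_ (cong (λ x → χ (x ≟ᶠ c)) (X≡Y zero here))
    (isConstOn-dependsOnlyOn p c _ _ (λ u u∈p → X≡Y (suc u) (there u∈p)))
  isConstOn-dependsOnlyOn (false ∷ p) c X Y X≡Y = isConstOn-dependsOnlyOn p c _ _ (λ u u∈p → X≡Y (suc u) (there u∈p))

  total-isConstOn-≤ : ∀ {n} (p : Subset n) (c : Fin q) (ℓ : Fin n → Fin q → ℕ) (w : Colouring n q → ℕ) (L : ℕ) →
    (∀ u x → ℓ u x ≤ 1) → (∀ u → u ∈ p → L ≤ sum (ℓ u)) → DependsOnlyOn (_∉ p) w →
    total n (λ X → isConstOn p c X * w X * productWeight ℓ X) * L ^ ∣ p ∣ ≤ total n (λ X → w X * productWeight ℓ X)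
  total-isConstOn-≤ {zero} [] c ℓ w L _ _ _ = ≤-reflexive (unit (w _))
    where
    unit : ∀ x → 1 * x * 1 * 1 ≡ x * 1
    unit = solve-∀
  total-isConstOn-≤ {suc n} (b ∷ p) c ℓ w L ℓ≤1 L≤ℓ w-dep = by-head b L≤ℓ w-dep
    where
    π = productWeight (ℓ ∘ suc)
    pinnedTail freeTail : Fin q → ℕ
    pinnedTail d = total n (λ X → isConstOn p c X * w (d Vector.∷ X) * π X)
    freeTail d = total n (λ X → w (d Vector.∷ X) * π X)
    tail-bound : ∀ {b} → (∀ u → u ∈ b ∷ p → L ≤ sum (ℓ u)) → DependsOnlyOn (_∉ b ∷ p) w →
      ∀ d → pinnedTail d * L ^ ∣ p ∣ ≤ freeTail d
    tail-bound L≤ℓ w-dep d = total-isConstOn-≤ p c (ℓ ∘ suc) (w ∘ (d Vector.∷_)) L (ℓ≤1 ∘ suc)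
      (λ u u∈p → L≤ℓ (suc u) (there u∈p)) (dependsOnlyOn-∉-tail w-dep d)
    regroup : ∀ a b x y → a * b * (x * y) ≡ a * x * (b * y)
    regroup = solve-∀
    reassoc : ∀ x y z o → x * y * z * o ≡ x * (y * z * o)
    reassoc = solve-∀
    swap-factors : ∀ a b x → a * (b * x) ≡ b * (a * x)
    swap-factors = solve-∀
    by-head : ∀ b → (∀ u → u ∈ b ∷ p → L ≤ sum (ℓ u)) → DependsOnlyOn (_∉ b ∷ p) w →
      total (suc n) (λ X → isConstOn (b ∷ p) c X * w X * productWeight ℓ X) * L ^ ∣ b ∷ p ∣
        ≤ total (suc n) (λ X → w X * productWeight ℓ X)
    by-head true L≤ℓ w-dep = begin
      total (suc n) (λ X → isConstOn (true ∷ p) c X * w X * productWeight ℓ X) * (L * L ^ ∣ p ∣)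
        ≡⟨ cong (_* (L * L ^ ∣ p ∣)) head-pinned ⟩
      ℓ zero c * pinnedTail c * (L * L ^ ∣ p ∣)    ≡⟨ regroup (ℓ zero c) (pinnedTail c) L (L ^ ∣ p ∣) ⟩
      (ℓ zero c * L) * (pinnedTail c * L ^ ∣ p ∣)
        ≤⟨ *-mono-≤ (*-mono-≤ (ℓ≤1 zero c) (L≤ℓ zero here)) (tail-bound L≤ℓ w-dep c) ⟩
      (1 * sum (ℓ zero)) * freeTail c             ≡⟨ cong (_* freeTail c) (*-identityˡ (sum (ℓ zero))) ⟩
      sum (ℓ zero) * freeTail c                   ≡⟨ *-distribʳ-sum (freeTail c) (ℓ zero) ⟩
      ∑[ d < q ] (ℓ zero d * freeTail c)
        ≡⟨ sum-cong-≗ {q} (λ d → cong (ℓ zero d *_) (total-cong n (λ X →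
             cong (_* π X) (dependsOnlyOn-∉-ignoresHead w-dep c d X)))) ⟩
      ∑[ d < q ] (ℓ zero d * freeTail d)          ≡⟨ total-weighted-product n ℓ w ⟨
      total (suc n) (λ X → w X * productWeight ℓ X) ∎
      where
      open ≤-Reasoning
      head-pinned : total (suc n) (λ X → isConstOn (true ∷ p) c X * w X * productWeight ℓ X) ≡ ℓ zero c * pinnedTail c
      head-pinned = begin-equality
        total (suc n) (λ X → isConstOn (true ∷ p) c X * w X * productWeight ℓ X)
          ≡⟨ total-weighted-product n ℓ (λ X → isConstOn (true ∷ p) c X * w X) ⟩
        ∑[ d < q ] (ℓ zero d * total n (λ X → χ (d ≟ᶠ c) * isConstOn p c X * w (d Vector.∷ X) * π X))
          ≡⟨ sum-cong-≗ {q} (λ d → cong (ℓ zero d *_)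
               (trans (total-cong n (λ X → reassoc (χ (d ≟ᶠ c)) _ _ _)) (total-*ˡ n (χ (d ≟ᶠ c)) _))) ⟩
        ∑[ d < q ] (ℓ zero d * (χ (d ≟ᶠ c) * pinnedTail d))
          ≡⟨ sum-cong-≗ {q} (λ d → swap-factors (ℓ zero d) (χ (d ≟ᶠ c)) (pinnedTail d)) ⟩
        ∑[ d < q ] (χ (d ≟ᶠ c) * (ℓ zero d * pinnedTail d))
          ≡⟨ sum-pick′ c (λ d → ℓ zero d * pinnedTail d) ⟩
        ℓ zero c * pinnedTail c ∎
    by-head false L≤ℓ w-dep = begin
      total (suc n) (λ X → isConstOn p c (X ∘ suc) * w X * productWeight ℓ X) * L ^ ∣ p ∣
        ≡⟨ cong (_* L ^ ∣ p ∣) (total-weighted-product n ℓ (λ X → isConstOn p c (X ∘ suc) * w X)) ⟩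
      ∑[ d < q ] (ℓ zero d * pinnedTail d) * L ^ ∣ p ∣
        ≡⟨ *-distribʳ-sum (L ^ ∣ p ∣) (λ d → ℓ zero d * pinnedTail d) ⟩
      ∑[ d < q ] (ℓ zero d * pinnedTail d * L ^ ∣ p ∣)
        ≤⟨ sum-mono {q} (λ d → ≤-trans (≤-reflexive (*-assoc (ℓ zero d) (pinnedTail d) _))
                                        (*-monoʳ-≤ (ℓ zero d) (tail-bound L≤ℓ w-dep d))) ⟩
      ∑[ d < q ] (ℓ zero d * freeTail d)          ≡⟨ total-weighted-product n ℓ w ⟨
      total (suc n) (λ X → w X * productWeight ℓ X) ∎
      where open ≤-Reasoning

  recolour : ∀ {n} → Colouring n q → Fin n → Fin q → Colouring n q
  recolour X zero    c = c Vector.∷ (X ∘ suc)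
  recolour X (suc v) c = X zero Vector.∷ recolour (X ∘ suc) v c

  recolour-at : ∀ {n} (X : Colouring n q) v c → recolour X v c v ≡ c
  recolour-at X zero    c = refl
  recolour-at X (suc v) c = recolour-at (X ∘ suc) v c

  recolour-elsewhere : ∀ {n} (X : Colouring n q) v c u → u ≢ v → recolour X v c u ≡ X u
  recolour-elsewhere X zero    c zero    u≢v = ⊥-elim (u≢v refl)
  recolour-elsewhere X zero    c (suc u) u≢v = refl
  recolour-elsewhere X (suc v) c zero    u≢v = refl
  recolour-elsewhere X (suc v) c (suc u) u≢v = recolour-elsewhere (X ∘ suc) v c u (u≢v ∘ cong suc)

  -- Recolouring v to c is a bijection from the colourings with X v ≡ c′ onto those with X v ≡ c.
  total-recolour : ∀ {n} (v : Fin n) (c c′ : Fin q) (w : Colouring n q → ℕ) →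
    total n (λ X → w (recolour X v c) * χ (X v ≟ᶠ c′)) ≡ total n (λ X → w X * χ (X v ≟ᶠ c))
  total-recolour {suc n} zero c c′ w = begin
    ∑[ d < q ] total n (λ X → w (c Vector.∷ X) * χ (d ≟ᶠ c′))
      ≡⟨ sum-cong-≗ {q} (λ d → pull-indicator d c′ (λ _ → c)) ⟩
    ∑[ d < q ] (χ (d ≟ᶠ c′) * total n (λ X → w (c Vector.∷ X)))   ≡⟨ sum-pick′ c′ _ ⟩
    total n (λ X → w (c Vector.∷ X))                              ≡⟨ sym (sum-pick′ c _) ⟩
    ∑[ d < q ] (χ (d ≟ᶠ c) * total n (λ X → w (d Vector.∷ X)))
      ≡⟨ sym (sum-cong-≗ {q} (λ d → pull-indicator d c id)) ⟩
    ∑[ d < q ] total n (λ X → w (d Vector.∷ X) * χ (d ≟ᶠ c)) ∎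
    where
    open ≡-Reasoning
    pull-indicator : ∀ d e (col : Fin q → Fin q) →
      total n (λ X → w (col d Vector.∷ X) * χ (d ≟ᶠ e)) ≡ χ (d ≟ᶠ e) * total n (λ X → w (col d Vector.∷ X))
    pull-indicator d e col = trans (total-cong n (λ X → *-comm (w (col d Vector.∷ X)) _)) (total-*ˡ n (χ (d ≟ᶠ e)) _)
  total-recolour {suc n} (suc v) c c′ w = sum-cong-≗ {q} (λ d → total-recolour v c c′ (w ∘ (d Vector.∷_)))

  productWeight-χ : ∀ {n} {P : Fin n → Fin q → Set} (P? : ∀ u x → Dec (P u x)) (X : Colouring n q) →
    (all-P? : Dec (∀ u → P u (X u))) → productWeight (λ u x → χ (P? u x)) X ≡ χ all-P?
  productWeight-χ {zero} P? X (yes _)  = refl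
  productWeight-χ {zero} P? X (no ¬all) = ⊥-elim (¬all λ ())
  productWeight-χ {suc n} P? X all-P? with P? zero (X zero)
  ... | no ¬P0 = sym (χ-no all-P? (λ all → ¬P0 (all zero)))
  ... | yes P0 = trans (+-identityʳ _)
    (trans (productWeight-χ (P? ∘ suc) (X ∘ suc) (all? (λ u → P? (suc u) (X (suc u)))))
           (χ-cong (λ all → λ { zero → P0 ; (suc u) → all u }) (λ all u → all (suc u)) _ all-P?))

-- Avoiding monochromatic edges

module _ {q n : ℕ} where

  Avoids : List (Subset n) → Colouring n q → Set
  Avoids T X = All (λ g → ¬ Monochromatic X g) T

  avoids? : ∀ T X → Dec (Avoids T X)
  avoids? T X = All.all? (λ g → ¬? (monochromatic? X g)) T

  massAvoiding : List (Subset n) → (Colouring n q → ℕ) → ℕ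
  massAvoiding T w = total n (λ X → χ (avoids? T X) * w X)

  massAvoiding≤total : ∀ T w → massAvoiding T w ≤ total n w
  massAvoiding≤total T w = total-mono n (λ X → χ*≤ (avoids? T X) (w X))

  isMono : Subset n → Colouring n q → ℕ
  isMono g X = χ (monochromatic? X g)

  monochromatic-transfer : ∀ (P : Fin n → Set) g (X Y : Colouring n q) → (∀ u → u ∈ g → P u) →
    (∀ u → P u → X u ≡ Y u) → Monochromatic Y g → Monochromatic X g
  monochromatic-transfer P g X Y g⊆P X≡Y (c , Y≡c) = c , λ u u∈g → trans (X≡Y u (g⊆P u u∈g)) (Y≡c u u∈g)

  isMono-dependsOnlyOn : ∀ g → DependsOnlyOn (_∈ g) (isMono g)
  isMono-dependsOnlyOn g X Y X≡Y = χ-cong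
    (monochromatic-transfer (_∈ g) g Y X (λ _ u∈g → u∈g) (λ u u∈g → sym (X≡Y u u∈g)))
    (monochromatic-transfer (_∈ g) g X Y (λ _ u∈g → u∈g) X≡Y) _ _

  avoids-dependsOnlyOn : ∀ W T → All (λ g → ¬ Meets W g) T → DependsOnlyOn (_∉ W) (χ ∘ avoids? T)
  avoids-dependsOnlyOn W T disjoint X Y X≡Y =
    χ-cong (transfer X Y X≡Y) (transfer Y X (λ u u∉W → sym (X≡Y u u∉W))) _ _
    where
    transfer : ∀ X Y → (∀ u → u ∉ W → X u ≡ Y u) → Avoids T X → Avoids T Y
    transfer X Y X≡Y avoidsX = All.zipWith
      (λ { {g} (g∩W≡∅ , ¬monoX) monoY →
             ¬monoX (monochromatic-transfer (_∉ W) g X Y (λ u u∈g u∈W → g∩W≡∅ (u , u∈W , u∈g)) X≡Y monoY) })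
      (disjoint , avoidsX)

  massAvoiding-insert : ∀ R g T (w : Colouring n q → ℕ) →
    massAvoiding (R ++ g ∷ T) w + massAvoiding (R ++ T) (λ X → isMono g X * w X) ≡ massAvoiding (R ++ T) w
  massAvoiding-insert R g T w = trans (sym (total-+ n _ _)) (total-cong n pointwise)
    where
    avoids-insert : ∀ X → Avoids (R ++ g ∷ T) X → Avoids (R ++ T) X × ¬ Monochromatic X g
    avoids-insert X = All-remove R T
    avoids-remove : ∀ X → Avoids (R ++ T) X × ¬ Monochromatic X g → Avoids (R ++ g ∷ T) X
    avoids-remove X (avoids , ¬mono) with ++⁻ R avoids
    ... | avoids-R , avoids-T = ++⁺ avoids-R (¬mono ∷ avoids-T)
    split : ∀ a ¬mono mono w → ¬mono + mono ≡ 1 → a * ¬mono * w + a * (mono * w) ≡ a * w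
    split a ¬mono mono w ¬mono+mono≡1 = begin
      a * ¬mono * w + a * (mono * w) ≡⟨ factor a ¬mono mono w ⟩
      a * (¬mono + mono) * w         ≡⟨ cong (λ t → a * t * w) ¬mono+mono≡1 ⟩
      a * 1 * w                      ≡⟨ cong (_* w) (*-identityʳ a) ⟩
      a * w                          ∎
      where
      open ≡-Reasoning
      factor : ∀ a b c w → a * b * w + a * (c * w) ≡ a * (b + c) * w
      factor = solve-∀
    pointwise : ∀ X → χ (avoids? (R ++ g ∷ T) X) * w X + χ (avoids? (R ++ T) X) * (isMono g X * w X)
                      ≡ χ (avoids? (R ++ T) X) * w X
    pointwise X = trans
      (cong (λ t → t * w X + χ (avoids? (R ++ T) X) * (isMono g X * w X))
        (trans (χ-cong (avoids-insert X) (avoids-remove X) (avoids? (R ++ g ∷ T) X) (avoids? (R ++ T) X ×-dec ¬? (monochromatic? X g)))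
               (χ-× (avoids? (R ++ T) X) (¬? (monochromatic? X g)))))
      (split (χ (avoids? (R ++ T) X)) _ (isMono g X) (w X) (χ-¬+χ (monochromatic? X g)))

isMono≤∑isConstOn : ∀ {n q} (g : Subset n) u₀ → u₀ ∈ g → (X : Colouring n q) →
  isMono g X ≤ ∑[ d < q ] (χ (X u₀ ≟ᶠ d) * isConstOn (g - u₀) d X)
isMono≤∑isConstOn g u₀ u₀∈g X with monochromatic? X g
... | no _ = z≤n
... | yes (_ , X≡d) = ≤-trans
  (≤-reflexive (sym (cong₂ _*_ (χ-yes (X u₀ ≟ᶠ X u₀) refl)
    (isConstOn≡1 (g - u₀) (X u₀) X (λ u u∈g-u₀ → trans (X≡d u (p─q⊆p g _ u∈g-u₀)) (sym (X≡d u₀ u₀∈g)))))))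
  (term≤sum (λ d → χ (X u₀ ≟ᶠ d) * isConstOn (g - u₀) d X) (X u₀))

-- Fixing the colour d of u₀, the rest of g must be pinned to d as well.
total-isMono-≤ : ∀ {n q} (ℓ : Fin n → Fin q → ℕ) L g u₀ → u₀ ∈ g → (∀ u x → ℓ u x ≤ 1) →
  (∀ u → u ∈ g - u₀ → L ≤ sum (ℓ u)) →
  total n (λ X → isMono g X * productWeight ℓ X) * L ^ ∣ g - u₀ ∣ ≤ total n (productWeight ℓ)
total-isMono-≤ {n} {q} ℓ L g u₀ u₀∈g ℓ≤1 L≤ℓ = begin
  total n (λ X → isMono g X * π X) * P
    ≤⟨ *-monoˡ-≤ P (total-mono n (λ X → *-monoˡ-≤ (π X) (isMono≤∑isConstOn g u₀ u₀∈g X))) ⟩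
  total n (λ X → ∑[ d < q ] (χ (X u₀ ≟ᶠ d) * isConstOn (g - u₀) d X) * π X) * P
    ≡⟨ cong (_* P) (trans (total-cong n (λ X → *-distribʳ-sum (π X) (λ d → χ (X u₀ ≟ᶠ d) * isConstOn (g - u₀) d X)))
                           (total-sum n (λ d X → χ (X u₀ ≟ᶠ d) * isConstOn (g - u₀) d X * π X))) ⟩
  ∑[ d < q ] total n (λ X → χ (X u₀ ≟ᶠ d) * isConstOn (g - u₀) d X * π X) * P
    ≡⟨ *-distribʳ-sum P (λ d → total n (λ X → χ (X u₀ ≟ᶠ d) * isConstOn (g - u₀) d X * π X)) ⟩
  ∑[ d < q ] (total n (λ X → χ (X u₀ ≟ᶠ d) * isConstOn (g - u₀) d X * π X) * P)
    ≡⟨ sum-cong-≗ {q} (λ d → cong (_* P) (total-cong n (λ X → cong (_* π X) (*-comm (χ (X u₀ ≟ᶠ d)) _)))) ⟩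
  ∑[ d < q ] (total n (λ X → isConstOn (g - u₀) d X * χ (X u₀ ≟ᶠ d) * π X) * P)
    ≤⟨ sum-mono {q} (λ d → total-isConstOn-≤ (g - u₀) d ℓ (λ X → χ (X u₀ ≟ᶠ d)) L ℓ≤1 L≤ℓ
                              (λ X Y X≡Y → cong (λ x → χ (x ≟ᶠ d)) (X≡Y u₀ (x∉p-x g u₀)))) ⟩
  ∑[ d < q ] total n (λ X → χ (X u₀ ≟ᶠ d) * π X)
    ≡⟨ total-sum n (λ d X → χ (X u₀ ≟ᶠ d) * π X) ⟨
  total n (λ X → ∑[ d < q ] (χ (X u₀ ≟ᶠ d) * π X))
    ≡⟨ total-cong n (λ X → sum-pick (X u₀) (λ _ → π X)) ⟩
  total n π ∎
  where
  open ≤-Reasoning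
  π = productWeight ℓ
  P = L ^ ∣ g - u₀ ∣

module LocalLemma {q n : ℕ} (ℓ : Fin n → Fin q → ℕ) (m k : ℕ) where

  π : Colouring n q → ℕ
  π = productWeight ℓ

  Rare : Subset n → Set
  Rare g = ∣ g ∣ ≤ k × 2 * m * total n (λ X → isMono g X * π X) ≤ total n π

  SparselyMeets : List (Subset n) → Set
  SparselyMeets T = ∀ W → ∣ W ∣ ≤ k → 2 * length (filter (meets? W) T) ≤ m

  -- Cross-multiplied: conditioned on avoiding T, g is monochromatic with probability at most 1/m.
  ConditionallyRare : ℕ → Set
  ConditionallyRare L = ∀ T → length T < L → All Rare T → SparselyMeets T → ∀ g → Rare g →
    m * massAvoiding T (λ X → isMono g X * π X) ≤ massAvoiding T π

  massAvoiding-insert-≥ : ∀ R g T → m * massAvoiding (R ++ T) (λ X → isMono g X * π X) ≤ massAvoiding (R ++ T) π →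
    (m ∸ 1) * massAvoiding (R ++ T) π ≤ m * massAvoiding (R ++ g ∷ T) π
  massAvoiding-insert-≥ R g T g-rare =
    [m∸1]*z≤m*x m (massAvoiding (R ++ g ∷ T) π) _ _ (≤-reflexive (sym (massAvoiding-insert R g T π))) g-rare

  sparselyMeets-remove : ∀ R g T → SparselyMeets (R ++ g ∷ T) → SparselyMeets (R ++ T)
  sparselyMeets-remove R g T sparse W ∣W∣≤k =
    ≤-trans (*-monoʳ-≤ 2 (length-filter-insert (meets? W) R g T)) (sparse W ∣W∣≤k)

  massAvoiding-dropFilter : ∀ L → ConditionallyRare L → ∀ {p} {P : Subset n → Set p} (P? : ∀ g → Dec (P g)) R T →
    length (R ++ T) ≤ L → All Rare (R ++ T) → SparselyMeets (R ++ T) →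
    (m ∸ 1) ^ length (filter P? T) * massAvoiding (R ++ filter (¬? ∘ P?) T) π
      ≤ m ^ length (filter P? T) * massAvoiding (R ++ T) π
  massAvoiding-dropFilter L rare P? R []      _   _    _      = ≤-refl
  massAvoiding-dropFilter L rare P? R (g ∷ T) len≤L all-rare sparse with P? g
  ... | yes _ = begin
    (m ∸ 1) * (m ∸ 1) ^ a * dropped       ≡⟨ *-assoc (m ∸ 1) _ dropped ⟩
    (m ∸ 1) * ((m ∸ 1) ^ a * dropped)     ≤⟨ *-monoʳ-≤ (m ∸ 1) rest ⟩
    (m ∸ 1) * (m ^ a * without-g)         ≡⟨ x∙yz≈y∙xz (m ∸ 1) (m ^ a) without-g ⟩
    m ^ a * ((m ∸ 1) * without-g)         ≤⟨ *-monoʳ-≤ (m ^ a) (massAvoiding-insert-≥ R g T g-rare) ⟩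
    m ^ a * (m * with-g)                  ≡⟨ x∙yz≈y∙xz (m ^ a) m with-g ⟩
    m * (m ^ a * with-g)                  ≡⟨ *-assoc m (m ^ a) with-g ⟨
    m * m ^ a * with-g                    ∎
    where
    open ≤-Reasoning
    a = length (filter P? T)
    dropped = massAvoiding (R ++ filter (¬? ∘ P?) T) π
    with-g = massAvoiding (R ++ g ∷ T) π
    without-g = massAvoiding (R ++ T) π
    len< : length (R ++ T) < L
    len< = subst (_≤ L) (length-++-sucʳ R g T) len≤L
    rare-R++T = proj₁ (All-remove R T all-rare)
    sparse-R++T = sparselyMeets-remove R g T sparse
    rest = massAvoiding-dropFilter L rare P? R T (<⇒≤ len<) rare-R++T sparse-R++T
    g-rare = rare (R ++ T) len< rare-R++T sparse-R++T g (proj₂ (All-remove R T all-rare))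
  ... | no _ = subst₂ (λ U V → (m ∸ 1) ^ a * massAvoiding U π ≤ m ^ a * massAvoiding V π)
    (++-assoc R (g ∷ []) (filter (¬? ∘ P?) T)) (++-assoc R (g ∷ []) T)
    (massAvoiding-dropFilter L rare P? (R ++ g ∷ []) T (subst (λ U → length U ≤ L) (sym reassoc) len≤L)
      (subst (All Rare) (sym reassoc) all-rare) (subst SparselyMeets (sym reassoc) sparse))
    where
    a = length (filter P? T)
    reassoc = ++-assoc R (g ∷ []) T

  -- Avoiding only the edges that miss W is independent of B, and restoring the at most m/2
  -- edges that meet W costs at most a factor 2.
  massAvoiding-localWeight : ∀ L → ConditionallyRare L → ∀ T → length T ≤ L → All Rare T → SparselyMeets T →
    ∀ W (B : Colouring n q → ℕ) → DependsOnlyOn (_∈ W) B → ∣ W ∣ ≤ k →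
    massAvoiding T (λ X → B X * π X) * total n π ≤ 2 * total n (λ X → B X * π X) * massAvoiding T π
  massAvoiding-localWeight L rare T len≤L all-rare sparse W B B-dep ∣W∣≤k = begin
    massAvoiding T (λ X → B X * π X) * total n π
      ≤⟨ *-monoˡ-≤ (total n π) (total-mono n (λ X → *-monoˡ-≤ (B X * π X)
           (χ-mono (filter⁺ (¬? ∘ meets? W)) (avoids? T X) (avoids? far X)))) ⟩
    massAvoiding far (λ X → B X * π X) * total n π
      ≡⟨ cong (_* total n π) (total-cong n (λ X → x∙yz≈y∙xz (χ (avoids? far X)) (B X) (π X))) ⟩
    total n (λ X → B X * (χ (avoids? far X) * π X)) * total n π
      ≡⟨ cong (_* total n π) (total-cong n (λ X → sym (*-assoc (B X) _ (π X)))) ⟩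
    total n (λ X → B X * χ (avoids? far X) * π X) * total n π
      ≡⟨ total-independent W ℓ B (χ ∘ avoids? far) B-dep (avoids-dependsOnlyOn W far (all-filter (¬? ∘ meets? W) T)) ⟩
    total n (λ X → B X * π X) * massAvoiding far π
      ≤⟨ *-monoʳ-≤ (total n (λ X → B X * π X)) far≤2 ⟩
    total n (λ X → B X * π X) * (2 * massAvoiding T π)
      ≡⟨ x∙yz≈y∙xz (total n (λ X → B X * π X)) 2 _ ⟩
    2 * (total n (λ X → B X * π X) * massAvoiding T π)
      ≡⟨ *-assoc 2 (total n (λ X → B X * π X)) (massAvoiding T π) ⟨
    2 * total n (λ X → B X * π X) * massAvoiding T π ∎
    where
    open ≤-Reasoning
    far = filter (¬? ∘ meets? W) T
    a = length (filter (meets? W) T)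
    2a≤m = sparse W ∣W∣≤k
    instance
      m^a≢0 : NonZero (m ^ a)
      m^a≢0 = >-nonZero (^-positive m a 2a≤m)
    far≤2 : massAvoiding far π ≤ 2 * massAvoiding T π
    far≤2 = *-cancelˡ-≤ (m ^ a) (begin
      m ^ a * massAvoiding far π                ≤⟨ *-monoˡ-≤ (massAvoiding far π) (^≤2*pred^ m a 2a≤m) ⟩
      2 * (m ∸ 1) ^ a * massAvoiding far π      ≡⟨ *-assoc 2 ((m ∸ 1) ^ a) _ ⟩
      2 * ((m ∸ 1) ^ a * massAvoiding far π)    ≤⟨ *-monoʳ-≤ 2 (massAvoiding-dropFilter L rare (meets? W) [] T len≤L all-rare sparse) ⟩
      2 * (m ^ a * massAvoiding T π)            ≡⟨ x∙yz≈y∙xz 2 (m ^ a) _ ⟩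
      m ^ a * (2 * massAvoiding T π)            ∎)

  conditionallyRare : ∀ L → ConditionallyRare L
  conditionallyRare (suc L) T (s≤s len≤L) all-rare sparse g (∣g∣≤k , g-rare) with total n π ≟ 0
  ... | yes total≡0 = ≤-trans (≤-reflexive (trans (cong (m *_) mono≡0) (*-zeroʳ m))) z≤n
    where
    mono≡0 : massAvoiding T (λ X → isMono g X * π X) ≡ 0
    mono≡0 = n≤0⇒n≡0 (≤-trans (massAvoiding≤total T _)
                        (≤-trans (total-mono n (λ X → χ*≤ (monochromatic? X g) (π X))) (≤-reflexive total≡0)))
  ... | no total≢0 = *-cancelʳ-≤ _ _ (total n π) {{≢-nonZero total≢0}} (begin
    m * mono * total n π                      ≡⟨ *-assoc m mono _ ⟩
    m * (mono * total n π)
      ≤⟨ *-monoʳ-≤ m (massAvoiding-localWeight L (conditionallyRare L) T len≤L all-rare sparse g (isMono g) (isMono-dependsOnlyOn g) ∣g∣≤k) ⟩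
    m * (2 * total n (λ X → isMono g X * π X) * massAvoiding T π)  ≡⟨ regroup m (total n (λ X → isMono g X * π X)) _ ⟩
    2 * m * total n (λ X → isMono g X * π X) * massAvoiding T π     ≤⟨ *-monoˡ-≤ (massAvoiding T π) g-rare ⟩
    total n π * massAvoiding T π              ≡⟨ *-comm (total n π) _ ⟩
    massAvoiding T π * total n π              ∎)
    where
    open ≤-Reasoning
    mono = massAvoiding T (λ X → isMono g X * π X)
    regroup : ∀ a b c → a * (2 * b * c) ≡ 2 * a * b * c
    regroup = solve-∀

-- Pinning the colour of v

module PinnedCounts {n q s : ℕ} (H : Hypergraph n) (h : Fin q → Fin s) (Λ : Subset n) (σ : Fin n → Fin s)
                    (v : Fin n) where

  E : List (Subset n)
  E = edges H

  Admissible : Fin q → Fin n → Fin q → Set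
  Admissible c u x = (u ∈ Λ → h x ≡ σ u) × (u ≡ v → x ≡ c)

  admissible? : ∀ c u x → Dec (Admissible c u x)
  admissible? c u x = ((u ∈? Λ) →-dec (h x ≟ᶠ σ u)) ×-dec ((u ≟ᶠ v) →-dec (x ≟ᶠ c))

  ℓ : Fin q → Fin n → Fin q → ℕ
  ℓ c u x = χ (admissible? c u x)

  pinned : Fin q → Colouring n q → ℕ
  pinned c = productWeight (ℓ c)

  pinned≡ : ∀ c X → pinned c X ≡ χ (consistent? h Λ σ X) * χ (X v ≟ᶠ c)
  pinned≡ c X = trans (productWeight-χ (admissible? c) X (all? (λ u → admissible? c u (X u))))
    (trans (χ-cong to from _ (consistent? h Λ σ X ×-dec (X v ≟ᶠ c))) (χ-× (consistent? h Λ σ X) (X v ≟ᶠ c)))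
    where
    to : (∀ u → Admissible c u (X u)) → Consistent h Λ σ X × X v ≡ c
    to admissible = (λ u u∈Λ → proj₁ (admissible u) u∈Λ) , proj₂ (admissible v) refl
    from : Consistent h Λ σ X × X v ≡ c → ∀ u → Admissible c u (X u)
    from (consistent , Xv≡c) u = consistent u , λ { refl → Xv≡c }

  Zpin : Fin q → ℕ
  Zpin c = massAvoiding E (pinned c)

  proper×consistent≡∑pinned : ∀ X →
    χ (proper? H X ×-dec consistent? h Λ σ X) ≡ ∑[ c < q ] (χ (avoids? E X) * pinned c X)
  proper×consistent≡∑pinned X = begin
    χ (proper? H X ×-dec consistent? h Λ σ X)          ≡⟨ χ-× (proper? H X) (consistent? h Λ σ X) ⟩
    χ (proper? H X) * χ (consistent? h Λ σ X)          ≡⟨ sum-pick (X v) (λ _ → χ (proper? H X) * χ (consistent? h Λ σ X)) ⟨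
    ∑[ c < q ] (χ (X v ≟ᶠ c) * (χ (proper? H X) * χ (consistent? h Λ σ X)))
      ≡⟨ sum-cong-≗ {q} (λ c → trans (regroup (χ (X v ≟ᶠ c)) (χ (proper? H X)) _) (cong (χ (proper? H X) *_) (sym (pinned≡ c X)))) ⟩
    ∑[ c < q ] (χ (avoids? E X) * pinned c X)          ∎
    where
    open ≡-Reasoning
    regroup : ∀ a p c → a * (p * c) ≡ p * (c * a)
    regroup = solve-∀

  Zcond≡∑Zpin : Zcond H h Λ σ ≡ ∑[ c < q ] Zpin c
  Zcond≡∑Zpin = begin
    Zcond H h Λ σ                                                   ≡⟨ count≡total n (λ X → proper? H X ×-dec consistent? h Λ σ X) ⟩
    total n (λ X → χ (proper? H X ×-dec consistent? h Λ σ X))       ≡⟨ total-cong n proper×consistent≡∑pinned ⟩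
    total n (λ X → ∑[ c < q ] (χ (avoids? E X) * pinned c X))       ≡⟨ total-sum n (λ c X → χ (avoids? E X) * pinned c X) ⟩
    ∑[ c < q ] Zpin c                                               ∎
    where open ≡-Reasoning

  Zcond-at≡∑Zpin : ∀ j → Zcond-at H h Λ σ v j ≡ ∑[ c < q ] (χ (h c ≟ᶠ j) * Zpin c)
  Zcond-at≡∑Zpin j = begin
    Zcond-at H h Λ σ v j
      ≡⟨ count≡total n (λ X → (proper? H X ×-dec consistent? h Λ σ X) ×-dec (h (X v) ≟ᶠ j)) ⟩
    total n (λ X → χ ((proper? H X ×-dec consistent? h Λ σ X) ×-dec (h (X v) ≟ᶠ j)))
      ≡⟨ total-cong n pointwise ⟩
    total n (λ X → ∑[ c < q ] (χ (h c ≟ᶠ j) * (χ (avoids? E X) * pinned c X)))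
      ≡⟨ total-sum n (λ c X → χ (h c ≟ᶠ j) * (χ (avoids? E X) * pinned c X)) ⟩
    ∑[ c < q ] total n (λ X → χ (h c ≟ᶠ j) * (χ (avoids? E X) * pinned c X))
      ≡⟨ sum-cong-≗ {q} (λ c → total-*ˡ n (χ (h c ≟ᶠ j)) _) ⟩
    ∑[ c < q ] (χ (h c ≟ᶠ j) * Zpin c) ∎
    where
    open ≡-Reasoning
    pointwise : ∀ X → χ ((proper? H X ×-dec consistent? h Λ σ X) ×-dec (h (X v) ≟ᶠ j))
                        ≡ ∑[ c < q ] (χ (h c ≟ᶠ j) * (χ (avoids? E X) * pinned c X))
    pointwise X = begin
      χ ((proper? H X ×-dec consistent? h Λ σ X) ×-dec (h (X v) ≟ᶠ j))
        ≡⟨ χ-× (proper? H X ×-dec consistent? h Λ σ X) (h (X v) ≟ᶠ j) ⟩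
      χ (proper? H X ×-dec consistent? h Λ σ X) * χ (h (X v) ≟ᶠ j)
        ≡⟨ cong (_* χ (h (X v) ≟ᶠ j)) (χ-× (proper? H X) (consistent? h Λ σ X)) ⟩
      χ (proper? H X) * χ (consistent? h Λ σ X) * χ (h (X v) ≟ᶠ j)
        ≡⟨ sum-pick (X v) (λ c → χ (proper? H X) * χ (consistent? h Λ σ X) * χ (h c ≟ᶠ j)) ⟨
      ∑[ c < q ] (χ (X v ≟ᶠ c) * (χ (proper? H X) * χ (consistent? h Λ σ X) * χ (h c ≟ᶠ j)))
        ≡⟨ sum-cong-≗ {q} (λ c → trans (regroup (χ (X v ≟ᶠ c)) (χ (proper? H X)) _ _)
                                       (cong (λ t → χ (h c ≟ᶠ j) * (χ (proper? H X) * t)) (sym (pinned≡ c X)))) ⟩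
      ∑[ c < q ] (χ (h c ≟ᶠ j) * (χ (avoids? E X) * pinned c X)) ∎
      where
      regroup : ∀ a p c hj → a * (p * c * hj) ≡ hj * (p * (c * a))
      regroup = solve-∀

  module Ratio {k Δ L : ℕ} (2≤k : 2 ≤ k) (1≤s : 1 ≤ s) (1≤L : 1 ≤ L) (L≤q : L ≤ q)
               (L≤preimage : ∀ i → L ≤ preimageSize h i) (large : 4 * k * Δ * s ≤ L ^ (k ∸ 1))
               (uniform : Uniform k H) (maxDegree : MaxDegreeAtMost Δ H) (v∉Λ : v ∉ Λ) where

    m ℒ : ℕ
    m = 2 * k * Δ
    ℒ = L ^ (k ∸ 1)

    2m≤ℒ : 2 * m ≤ ℒ
    2m≤ℒ = ≤-trans (≤-reflexive (regroup k Δ)) (≤-trans (*-monoʳ-≤ (4 * k * Δ) 1≤s) large)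
      where
      regroup : ∀ k Δ → 2 * (2 * k * Δ) ≡ 4 * k * Δ * 1
      regroup = solve-∀

    8Δs≤ℒ : 8 * Δ * s ≤ ℒ
    8Δs≤ℒ = begin
      8 * Δ * s        ≡⟨ regroup Δ s ⟩
      4 * 2 * (Δ * s)  ≤⟨ *-monoˡ-≤ (Δ * s) (*-monoʳ-≤ 4 2≤k) ⟩
      4 * k * (Δ * s)  ≡⟨ *-assoc (4 * k) Δ s ⟨
      4 * k * Δ * s    ≤⟨ large ⟩
      ℒ                ∎
      where
      open ≤-Reasoning
      regroup : ∀ Δ s → 8 * Δ * s ≡ 4 * 2 * (Δ * s)
      regroup = solve-∀

    1≤ℒ : 1 ≤ ℒ
    1≤ℒ = m^n>0 L {{>-nonZero 1≤L}} (k ∸ 1)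

    ℓ≤1 : ∀ c u x → ℓ c u x ≤ 1
    ℓ≤1 c u x = χ≤1 (admissible? c u x)

    L≤admissible : ∀ c u → u ≢ v → L ≤ sum (ℓ c u)
    L≤admissible c u u≢v with u ∈? Λ
    ... | yes u∈Λ = ≤-trans (L≤preimage (σ u)) (≤-reflexive (trans (preimageSize≡∑ h (σ u))
          (sum-cong-≗ {q} (λ x → χ-cong (λ hx≡σu → (λ _ → hx≡σu) , ⊥-elim ∘ u≢v) (λ adm → proj₁ adm u∈Λ) _ _))))
    ... | no u∉Λ  = ≤-trans L≤q (≤-reflexive (trans (sym (*-identityʳ q)) (trans (sym (sum-const {q} 1))
          (sum-cong-≗ {q} (λ x → sym (χ-yes _ ((⊥-elim ∘ u∉Λ) , ⊥-elim ∘ u≢v)))))))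

    ∣g-u∣≡k∸1 : ∀ {g : Subset n} {u} → u ∈ g → ∣ g ∣ ≡ k → ∣ g - u ∣ ≡ k ∸ 1
    ∣g-u∣≡k∸1 u∈g ∣g∣≡k = cong (_∸ 1) (trans (∣p-x∣+1≡∣p∣ u∈g) ∣g∣≡k)

    isMono-rare-via : ∀ c g → ∣ g ∣ ≡ k → ∀ u₀ → u₀ ∈ g → (∀ {u} → u ∈ g - u₀ → u ≢ v) →
      total n (λ X → isMono g X * pinned c X) * ℒ ≤ total n (pinned c)
    isMono-rare-via c g ∣g∣≡k u₀ u₀∈g ≢v =
      subst (λ t → total n (λ X → isMono g X * pinned c X) * L ^ t ≤ total n (pinned c)) (∣g-u∣≡k∸1 u₀∈g ∣g∣≡k)
        (total-isMono-≤ (ℓ c) L g u₀ u₀∈g (ℓ≤1 c) (λ u u∈g-u₀ → L≤admissible c u (≢v u∈g-u₀)))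

    -- u₀ is v when v ∈ g, so that every vertex of g - u₀ has at least L admissible colours.
    isMono-rare : ∀ c g → ∣ g ∣ ≡ k → total n (λ X → isMono g X * pinned c X) * ℒ ≤ total n (pinned c)
    isMono-rare c g ∣g∣≡k with v ∈? g
    ... | yes v∈g = isMono-rare-via c g ∣g∣≡k v v∈g y∈p-x⇒y≢x
    ... | no v∉g with ∣p∣>0⇒Nonempty (≤-trans (≤-trans (s≤s z≤n) 2≤k) (≤-reflexive (sym ∣g∣≡k)))
    ... | u₀ , u₀∈g = isMono-rare-via c g ∣g∣≡k u₀ u₀∈g (λ u∈g-u₀ u≡v → v∉g (subst (_∈ g) u≡v (p─q⊆p g _ u∈g-u₀)))

    module Pinned (c : Fin q) = LocalLemma (ℓ c) m k

    sparse : ∀ c → Pinned.SparselyMeets c E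
    sparse c W ∣W∣≤k = ≤-trans (*-monoʳ-≤ 2 (≤-trans (edgesMeeting-≤ H maxDegree W) (*-monoˡ-≤ Δ ∣W∣≤k)))
                               (≤-reflexive (sym (*-assoc 2 k Δ)))

    rare : ∀ c → All (Pinned.Rare c) E
    rare c = All.map (λ {g} ∣g∣≡k → ≤-reflexive ∣g∣≡k ,
      ≤-trans (*-monoˡ-≤ (total n (λ X → isMono g X * pinned c X)) 2m≤ℒ)
              (≤-trans (≤-reflexive (*-comm ℒ _)) (isMono-rare c g ∣g∣≡k))) uniform

    Ev : List (Subset n)
    Ev = filter (v ∈?_) E

    blockedBy : Subset n → Fin q → Fin q → ℕ
    blockedBy e c′ c = massAvoiding E (λ X → isConstOn (e - v) c X * pinned c′ X)

    blocked : Fin q → Fin q → ℕ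
    blocked c′ c = sumOver (λ e → blockedBy e c′ c) Ev

    blockedBy-≤ : ∀ c′ c e → ∣ e ∣ ≡ k → v ∈ e → blockedBy e c′ c * ℒ ≤ 2 * Zpin c′
    blockedBy-≤ c′ c e ∣e∣≡k v∈e with total n (pinned c′) ≟ 0
    ... | yes total≡0 = ≤-trans (≤-reflexive (cong (_* ℒ) blocked≡0)) z≤n
      where
      blocked≡0 : blockedBy e c′ c ≡ 0
      blocked≡0 = n≤0⇒n≡0 (≤-trans (massAvoiding≤total E _)
        (≤-trans (total-mono n (λ X → ≤-trans (*-monoˡ-≤ (pinned c′ X) (isConstOn≤1 (e - v) c X)) (≤-reflexive (*-identityˡ _))))
                 (≤-reflexive total≡0)))
    ... | no total≢0 = *-cancelʳ-≤ _ _ (total n (pinned c′)) {{≢-nonZero total≢0}} (begin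
      blockedBy e c′ c * ℒ * total n (pinned c′)       ≡⟨ x∙yz≈y∙xz-right (blockedBy e c′ c) ℒ _ ⟩
      blockedBy e c′ c * total n (pinned c′) * ℒ
        ≤⟨ *-monoˡ-≤ ℒ (Pinned.massAvoiding-localWeight c′ (length E) (Pinned.conditionallyRare c′ (length E)) E ≤-refl
             (rare c′) (sparse c′) (e - v) (isConstOn (e - v) c) (isConstOn-dependsOnlyOn (e - v) c) ∣e-v∣≤k) ⟩
      2 * pinnedOnEdge * Zpin c′ * ℒ                   ≡⟨ regroup pinnedOnEdge (Zpin c′) ℒ ⟩
      2 * Zpin c′ * (pinnedOnEdge * ℒ)                 ≤⟨ *-monoʳ-≤ (2 * Zpin c′) pinning ⟩
      2 * Zpin c′ * total n (pinned c′)                ∎)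
      where
      open ≤-Reasoning
      pinnedOnEdge = total n (λ X → isConstOn (e - v) c X * pinned c′ X)
      ∣e-v∣≤k : ∣ e - v ∣ ≤ k
      ∣e-v∣≤k = ≤-trans (n≤1+n _) (≤-reflexive (trans (∣p-x∣+1≡∣p∣ v∈e) ∣e∣≡k))
      x∙yz≈y∙xz-right : ∀ a b c → a * b * c ≡ a * c * b
      x∙yz≈y∙xz-right = solve-∀
      regroup : ∀ a b c → 2 * a * b * c ≡ 2 * b * (a * c)
      regroup = solve-∀
      pinning : pinnedOnEdge * ℒ ≤ total n (pinned c′)
      pinning = begin
        pinnedOnEdge * ℒ
          ≡⟨ cong (λ t → pinnedOnEdge * L ^ t) (∣g-u∣≡k∸1 v∈e ∣e∣≡k) ⟨
        pinnedOnEdge * L ^ ∣ e - v ∣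
          ≡⟨ cong (_* L ^ ∣ e - v ∣) (total-cong n (λ X → cong (_* pinned c′ X) (sym (*-identityʳ (isConstOn (e - v) c X))))) ⟩
        total n (λ X → isConstOn (e - v) c X * 1 * pinned c′ X) * L ^ ∣ e - v ∣
          ≤⟨ total-isConstOn-≤ (e - v) c (ℓ c′) (λ _ → 1) L (ℓ≤1 c′)
               (λ u u∈e-v → L≤admissible c′ u (y∈p-x⇒y≢x u∈e-v)) (λ _ _ _ → refl) ⟩
        total n (λ X → 1 * pinned c′ X)
          ≡⟨ total-cong n (λ X → *-identityˡ (pinned c′ X)) ⟩
        total n (pinned c′) ∎

    blocked-small : ∀ c′ c → 4 * s * blocked c′ c ≤ Zpin c′
    blocked-small c′ c = 4s*B≤N s Δ (blocked c′ c) (Zpin c′) ℒ blocked*ℒ≤ 8Δs≤ℒ 1≤ℒ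
      where
      blocked*ℒ≤ : blocked c′ c * ℒ ≤ Δ * (2 * Zpin c′)
      blocked*ℒ≤ = ≤-trans
        (sumOver-*-≤ (λ e → blockedBy e c′ c) ℒ (2 * Zpin c′) Ev
          (All.map (λ {e} (∣e∣≡k , v∈e) → blockedBy-≤ c′ c e ∣e∣≡k v∈e)
                   (All.zip (filter⁺ (v ∈?_) uniform , all-filter (v ∈?_) E))))
        (*-monoˡ-≤ (2 * Zpin c′) (maxDegree v))

    ConstOn : Colouring n q → Fin q → Subset n → Set
    ConstOn X c e = ∀ u → u ∈ e - v → X u ≡ c

    constOn? : ∀ X c e → Dec (ConstOn X c e)
    constOn? X c e = all? (λ u → (u ∈? e - v) →-dec (X u ≟ᶠ c))

    recolour-avoids : ∀ X c → Avoids E X → All (λ e → ¬ ConstOn X c e) Ev → Avoids E (recolour X v c)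
    recolour-avoids X c avoids unblocked = All.tabulate avoids-g
      where
      avoids-g : ∀ {g} → g List.∈ E → ¬ Monochromatic (recolour X v c) g
      avoids-g {g} g∈E (d , X′≡d) with v ∈? g
      ... | yes v∈g = All.lookup unblocked (∈-filter⁺ (v ∈?_) g∈E v∈g) λ u u∈g-v →
            trans (sym (recolour-elsewhere X v c u (y∈p-x⇒y≢x u∈g-v)))
                  (trans (X′≡d u (p─q⊆p g _ u∈g-v)) (trans (sym (X′≡d v v∈g)) (recolour-at X v c)))
      ... | no v∉g = All.lookup avoids g∈E
            (d , λ u u∈g → trans (sym (recolour-elsewhere X v c u (λ u≡v → v∉g (subst (_∈ g) u≡v u∈g)))) (X′≡d u u∈g))

    recolour-consistent : ∀ X c → Consistent h Λ σ X → Consistent h Λ σ (recolour X v c)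
    recolour-consistent X c consistent u u∈Λ =
      trans (cong h (recolour-elsewhere X v c u (λ u≡v → v∉Λ (subst (_∈ Λ) u≡v u∈Λ)))) (consistent u u∈Λ)

    -- A proper colouring with X v ≡ c′ either stays proper when v is recoloured to c,
    -- or has an edge through v whose other vertices are all coloured c.
    recolouring-bound : ∀ c c′ X →
      χ (avoids? E X) * pinned c′ X
        ≤ χ (avoids? E (recolour X v c)) * pinned c (recolour X v c) * χ (X v ≟ᶠ c′)
          + sumOver (λ e → χ (avoids? E X) * (isConstOn (e - v) c X * pinned c′ X)) Ev
    recolouring-bound c c′ X rewrite pinned≡ c′ X | pinned≡ c (recolour X v c)
      with avoids? E X | consistent? h Λ σ X | X v ≟ᶠ c′
    ... | no _       | _              | _     = z≤n
    ... | yes _      | no _           | _     = z≤n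
    ... | yes _      | yes _          | no _  = z≤n
    ... | yes avoids | yes consistent | yes _ with Any.any? (constOn? X c) Ev
    ... | yes blocking = ≤-trans
      (sumOver-≥-any (λ {e} const → ≤-reflexive (sym (cong (λ t → 1 * (t * (1 * 1))) (isConstOn≡1 (e - v) c X const)))) blocking)
      (m≤n+m _ _)
    ... | no unblocked = ≤-trans (≤-reflexive (sym recoloured-counts)) (m≤m+n _ _)
      where
      X′ = recolour X v c
      recoloured-counts : χ (avoids? E X′) * (χ (consistent? h Λ σ X′) * χ (X′ v ≟ᶠ c)) * 1 ≡ 1
      recoloured-counts = trans (*-identityʳ _) (cong₂ _*_
        (χ-yes (avoids? E X′) (recolour-avoids X c avoids (¬Any⇒All¬ Ev unblocked)))
        (cong₂ _*_ (χ-yes (consistent? h Λ σ X′) (recolour-consistent X c consistent)) (χ-yes (X′ v ≟ᶠ c) (recolour-at X v c))))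

    Zpin-≤ : ∀ c c′ → Zpin c′ ≤ Zpin c + blocked c′ c
    Zpin-≤ c c′ = begin
      Zpin c′                                                  ≤⟨ total-mono n (recolouring-bound c c′) ⟩
      total n (λ X → w (recolour X v c) * χ (X v ≟ᶠ c′) + obstruction X)  ≡⟨ total-+ n _ _ ⟩
      total n (λ X → w (recolour X v c) * χ (X v ≟ᶠ c′)) + total n obstruction
        ≡⟨ cong₂ _+_ (total-recolour v c c′ w) (total-sumOver n (λ e X → χ (avoids? E X) * (isConstOn (e - v) c X * pinned c′ X)) Ev) ⟩
      total n (λ X → w X * χ (X v ≟ᶠ c)) + blocked c′ c         ≤⟨ +-monoˡ-≤ (blocked c′ c) (total-mono n (λ X → *χ≤ X (w X))) ⟩
      Zpin c + blocked c′ c                                     ∎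
      where
      open ≤-Reasoning
      w : Colouring n q → ℕ
      w Y = χ (avoids? E Y) * pinned c Y
      obstruction : Colouring n q → ℕ
      obstruction X = sumOver (λ e → χ (avoids? E X) * (isConstOn (e - v) c X * pinned c′ X)) Ev
      *χ≤ : ∀ X x → x * χ (X v ≟ᶠ c) ≤ x
      *χ≤ X x = ≤-trans (≤-reflexive (*-comm x _)) (χ*≤ (X v ≟ᶠ c) x)

    Zpin-ratio : ∀ c c′ → (4 * s ∸ 1) * Zpin c′ ≤ 4 * s * Zpin c
    Zpin-ratio c c′ = [m∸1]*z≤m*x (4 * s) (Zpin c) (blocked c′ c) (Zpin c′) (Zpin-≤ c c′) (blocked-small c′ c)

lemma6p7 : (n k Δ q s : ℕ) → .{{_ : NonZero s}} → 2 ≤ k → 1 ≤ s → s ≤ q →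
    (H : Hypergraph n) → Uniform k H → MaxDegreeAtMost Δ H →
    (h : Fin q → Fin s) → Balanced q s h →
    toℚ (4 * q * s * Δ * k) ·e≤ toℚ ((q / s) ^ k) →
    (v : Fin n) (Λ : Subset n) → v ∉ Λ → (σ : Fin n → Fin s) → (j : Fin s) →
    -- |h⁻¹(j)|/q · (1 - 1/(4s)) ≤ ψ(j), cross-multiplied by 4 s q Z
    (preimageSize h j * (4 * s ∸ 1) * Zcond H h Λ σ ≤ 4 * s * q * Zcond-at H h Λ σ v j)
    -- ψ(j) ≤ |h⁻¹(j)|/q · (1 + 1/s), cross-multiplied by s q Z
    × (s * q * Zcond-at H h Λ σ v j ≤ preimageSize h j * (s + 1) * Zcond H h Λ σ)
lemma6p7 n k Δ q s 2≤k 1≤s s≤q H uniform maxDegree h balanced large v Λ v∉Λ σ j = lower , upper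
  where
  open PinnedCounts H h Λ σ v
  open ≤-Reasoning
  1≤q/s : 1 ≤ q / s
  1≤q/s = m≥n⇒m/n>0 s≤q
  open Ratio 2≤k 1≤s 1≤q/s (m/n≤m q s) (balanced⇒/≤preimageSize balanced)
             (^-pred-large k 1≤q/s (m/n≤m q s) (≤-trans (s≤s z≤n) 2≤k) (·e≤⇒≤ _ _ large)) uniform maxDegree v∉Λ
  inClass : Fin q → ℕ
  inClass c = χ (h c ≟ᶠ j)
  lower : preimageSize h j * (4 * s ∸ 1) * Zcond H h Λ σ ≤ 4 * s * q * Zcond-at H h Λ σ v j
  lower = begin
    preimageSize h j * (4 * s ∸ 1) * Zcond H h Λ σ ≡⟨ cong₂ (λ a z → a * (4 * s ∸ 1) * z) (preimageSize≡∑ h j) Zcond≡∑Zpin ⟩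
    sum inClass * (4 * s ∸ 1) * sum Zpin          ≤⟨ weighted-average-≥ inClass Zpin (4 * s ∸ 1) (4 * s) Zpin-ratio ⟩
    4 * s * q * ∑[ c < q ] (inClass c * Zpin c)   ≡⟨ cong (4 * s * q *_) (Zcond-at≡∑Zpin j) ⟨
    4 * s * q * Zcond-at H h Λ σ v j              ∎
  upper : s * q * Zcond-at H h Λ σ v j ≤ preimageSize h j * (s + 1) * Zcond H h Λ σ
  upper = begin
    s * q * Zcond-at H h Λ σ v j                  ≡⟨ cong (s * q *_) (Zcond-at≡∑Zpin j) ⟩
    s * q * ∑[ c < q ] (inClass c * Zpin c)
      ≤⟨ weighted-average-≤ inClass Zpin (s + 1) s (λ c c′ → 4s∸1-ratio⇒s+1-ratio s 1≤s _ _ (Zpin-ratio c′ c)) ⟩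
    sum inClass * (s + 1) * sum Zpin              ≡⟨ cong₂ (λ a z → a * (s + 1) * z) (preimageSize≡∑ h j) Zcond≡∑Zpin ⟨
    preimageSize h j * (s + 1) * Zcond H h Λ σ    ∎
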